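{- Let $n \geq 1$ and $d \geq 1$ be integers, and let $F_j$ denote the $j$th Fibonacci number ($F_0=0$, $F_1=1$). There exists $x \in \mathbb{Z}/F_{2n}\mathbb{Z}$ such that: (1) $x$ can be written (modulo $F_{2n}$) as a sum of $d-1$ or fewer numbers from $\{F_1, F_3, \ldots, F_{2n-1}\}$ (the odd-index Fibonacci numbers between $1$ and $F_{2n-1}$), and (2) for every $1 \leq k \leq n$, $x$ can be written (modulo $F_{2n}$) as a sum of $d$ or fewer numbers from $\{F_1, F_3, \ldots, F_{2n-1}\}$ with $F_{2k-1}$ as one of the summands, if and only if \[ d \geq \phi_n := \min \Big\{\lfloor \sqrt{n+1} \rfloor - 1 + \Big\lceil \frac{n+1-\lfloor \sqrt{n+1} \rfloor}{\lfloor \sqrt{n+1} \rfloor} \Big\rceil , \lceil \sqrt{n+1} \rceil - 1 + \Big\lceil \frac{n+1-\lceil \sqrt{n+1} \rceil}{\lceil \sqrt{n} \rceil} \Big\rceil \Big\}. \]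
   Context: Summands may be repeated; a sum of zero numbers is $0$. -}

module Defs where

open import Data.Nat using (ℕ; zero; suc; _+_; _*_; _∸_; _≤ᵇ_; _≡ᵇ_; _/_)
open import Data.Bool using (if_then_else_)
open import Data.Nat using (_⊓_) public
open import Data.List using (List; map)
open import Data.Nat.ListAction using (sum)
open import Data.Integer using (ℤ; +_; _-_)
open import Data.Integer.Divisibility using (_∣_)

fib : ℕ → ℕ
fib zero = 0
fib (suc zero) = 1
fib (suc (suc n)) = fib (suc n) + fib n

-- ⌊√m⌋ : the floor square root increases by at most one from m to m+1.
⌊√_⌋ : ℕ → ℕ
⌊√ zero ⌋ = 0
⌊√ suc m ⌋ = step ⌊√ m ⌋
  where
  step : ℕ → ℕ
  step s = if (suc s * suc s) ≤ᵇ suc m then suc s else s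

⌈√_⌉ : ℕ → ℕ
⌈√ m ⌉ = if (⌊√ m ⌋ * ⌊√ m ⌋) ≡ᵇ m then ⌊√ m ⌋ else suc ⌊√ m ⌋

-- ceiling division ⌈a / b⌉ for b ≥ 1 (junk value 0 when b = 0; never used)
cdiv : ℕ → ℕ → ℕ
cdiv a zero = 0
cdiv a (suc b) = (a + b) / suc b

φ : ℕ → ℕ
φ n = (⌊√ (n + 1) ⌋ ∸ 1 + cdiv (n + 1 ∸ ⌊√ (n + 1) ⌋) ⌊√ (n + 1) ⌋)
    ⊓ (⌈√ (n + 1) ⌉ ∸ 1 + cdiv (n + 1 ∸ ⌈√ (n + 1) ⌉) ⌈√ n ⌉)

oddFibSum : List ℕ → ℕ
oddFibSum ks = sum (map (λ k → fib (2 * k ∸ 1)) ks)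

_≡_[mod_] : ℕ → ℕ → ℕ → Set
a ≡ b [mod m ] = (+ m) ∣ (+ a - + b)

{-# OPTIONS --safe #-}
module Submission where

-- The path 1 — ⋯ — n together with a sink joined to every vertex is the fan graph. Weighting vertex v by
-- a_v = F_{2v−1} gives Δ a = F_{2n} e_n for its reduced Laplacian Δ, and a_n is a unit modulo F_{2n}
-- (Cassini); hence Σ a_v b_v ≡ 0 (mod F_{2n}) exactly when b = Δ f. So x is a divisor class and a list
-- of summands is an effective divisor in it, of degree the length of the list.
--
-- Lower bound: take a representative E of degree m < d and its longest chip-free run, of length ℓ. The
-- representative E′ = E − Δ f with a chip at the start of the run either shows that firing the vertices
-- where f is maximal gives a cheaper representative (descend), or −f ≥ 0 fires the whole run and
-- deg E′ ≥ m + ℓ, so m + ℓ ≤ d while n + 1 ≤ (m + 1)(ℓ + 1). Upper bound: chips at every (ℓ + 1)-th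
-- vertex; firing the complement of one gap puts a chip on each of its vertices at cost at most ℓ.
-- Finally φ_n is the least m + ℓ with n + 1 ≤ (m + 1)(ℓ + 1).

open import Defs
open import Data.Nat.Base using (ℕ)
open import Data.Bool using (Bool; true; false; T)
open import Data.Product using (Σ; Σ-syntax; ∃; _×_; _,_; proj₁; proj₂)
open import Data.Sum using (_⊎_; inj₁; inj₂)
import Data.Sum as Sum
open import Data.Empty using (⊥-elim)
open import Data.List using (List; []; _∷_; length; _++_; replicate; map)
open import Data.List.Properties using (length-++; length-replicate; map-++)
open import Data.Nat.ListAction using (sum)
open import Data.Nat.ListAction.Properties using (sum-++)
open import Data.List.Relation.Unary.All using (All; []; _∷_)
open import Data.List.Relation.Unary.All.Properties using (++⁺; replicate⁺)
open import Data.List.Relation.Unary.Any using (here; there)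
open import Data.List.Membership.Propositional using (_∈_)
open import Data.List.Membership.Propositional.Properties using (∈-++⁺ˡ; ∈-++⁺ʳ)
open import Function using (_∘_)
open import Relation.Nullary using (does; Dec; yes; no)
open import Relation.Nullary.Decidable using (dec-true; dec-false)
open import Induction.WellFounded using (Acc; acc)
open import Data.Nat.Induction using (<-wellFounded)
open import Relation.Binary.PropositionalEquality

module OddFibonacci where

  open import Data.Nat
  open import Data.Nat.Properties using (+-suc; +-cancelʳ-≡)
  open import Data.Nat.Tactic.RingSolver using (solve-∀)

  -- fib computes on double w, not on 2 * w
  double : ℕ → ℕ
  double zero = 0
  double (suc w) = suc (suc (double w))

  2*-double : ∀ w → 2 * w ≡ double w
  2*-double zero = refl
  2*-double (suc w) = cong suc (trans (+-suc w (w + 0)) (cong suc (2*-double w)))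

  oddFib : ℕ → ℕ
  oddFib v = fib (2 * v ∸ 1)

  oddFib-suc : ∀ w → oddFib (suc w) ≡ fib (suc (double w))
  oddFib-suc w = cong (λ m → fib (m ∸ 1)) (2*-double (suc w))

  fib-odd-recurrence : ∀ w →
    fib (suc (double (suc (suc w)))) + fib (suc (double w)) ≡ 3 * fib (suc (double (suc w)))
  fib-odd-recurrence w = identity (fib (suc (double w))) (fib (double w))
    where
    identity : ∀ x y → ((((x + y) + x) + (x + y)) + ((x + y) + x)) + x ≡ 3 * ((x + y) + x)
    identity = solve-∀

  fib-even-from-odd : ∀ w →
    2 * fib (suc (double (suc w))) ≡ fib (suc (double w)) + fib (double (suc (suc w)))
  fib-even-from-odd w = identity (fib (suc (double w))) (fib (double w))
    where
    identity : ∀ x y → 2 * ((x + y) + x) ≡ x + (((x + y) + x) + (x + y))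
    identity = solve-∀

  cassini-odd : ∀ p →
    fib (suc (double p)) * fib (suc (double p)) ≡ fib (double (suc p)) * fib (double p) + 1
  cassini-odd zero = refl
  cassini-odd (suc p) = +-cancelʳ-≡ ((x + y) * y) _ _ (begin
      ((x + y) + x) * ((x + y) + x) + (x + y) * y    ≡⟨ expand x y ⟩
      x * x + (((x + y) + x) + (x + y)) * (x + y)    ≡⟨ cong (_+ (((x + y) + x) + (x + y)) * (x + y)) (cassini-odd p) ⟩
      ((x + y) * y + 1) + (((x + y) + x) + (x + y)) * (x + y)
                                                     ≡⟨ regroup ((x + y) * y) ((((x + y) + x) + (x + y)) * (x + y)) ⟩
      (((x + y) + x) + (x + y)) * (x + y) + 1 + (x + y) * y ∎)
    where
    open ≡-Reasoning
    x = fib (suc (double p))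
    y = fib (double p)
    expand : ∀ x y → ((x + y) + x) * ((x + y) + x) + (x + y) * y
                   ≡ x * x + (((x + y) + x) + (x + y)) * (x + y)
    expand = solve-∀
    regroup : ∀ u v → (u + 1) + v ≡ v + 1 + u
    regroup = solve-∀

module Splitting where

  open import Data.Nat
  open import Data.Nat.Properties

  -- m chips leave m + 1 gaps of at most ℓ vertices each: they fit among n ≤ m + (m + 1) ℓ vertices.
  Affordable : ℕ → ℕ → Set
  Affordable n d = Σ[ m ∈ ℕ ] Σ[ ℓ ∈ ℕ ] (m + ℓ ≤ d × suc n ≤ suc m * suc ℓ)

  affordable-mono : ∀ {n d d′} → d ≤ d′ → Affordable n d → Affordable n d′
  affordable-mono d≤d′ (m , ℓ , budget , fits) = m , ℓ , ≤-trans budget d≤d′ , fits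

  -- With no gaps at all, one chip can be traded for gaps of length one.
  affordable-with-gap : ∀ {n d} → 1 ≤ n → Affordable n d →
    Σ[ m ∈ ℕ ] Σ[ ℓ ∈ ℕ ] (m + suc ℓ ≤ d × suc n ≤ suc m * suc (suc ℓ))
  affordable-with-gap _ (m , suc ℓ , budget , fits) = m , ℓ , budget , fits
  affordable-with-gap 1≤n (zero , zero , _ , s≤s n≤0) = ⊥-elim (<⇒≱ 1≤n n≤0)
  affordable-with-gap {n} {d} _ (suc m , zero , budget , fits) =
    m , 0 , subst (_≤ d) (trans (+-identityʳ (suc m)) (+-comm 1 m)) budget ,
    ≤-trans (subst (suc n ≤_) (*-identityʳ (suc (suc m))) fits) (s≤s (s≤s (m≤m*n m 2)))

module Phi where

  open import Data.Nat
  open import Data.Nat.Properties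
  open import Data.Nat.DivMod using (m≡m%n+[m/n]*n; m%n<n; m/n*n≤m)
  open import Data.Nat.Tactic.RingSolver using (solve-∀)
  open Splitting using (Affordable; affordable-mono)

  *-self-mono-< : ∀ {x y} → x < y → x * x < y * y
  *-self-mono-< x<y = *-mono-< x<y x<y

  *-self-cancel-≤ : ∀ {x y} → x * x ≤ y * y → x ≤ y
  *-self-cancel-≤ {x} {y} x²≤y² with x ≤? y
  ... | yes x≤y = x≤y
  ... | no x≰y = ⊥-elim (<⇒≱ (*-self-mono-< (≰⇒> x≰y)) x²≤y²)

  *-self-cancel-< : ∀ {x y} → x * x < y * y → x < y
  *-self-cancel-< {x} {y} x²<y² with y ≤? x
  ... | yes y≤x = ⊥-elim (<⇒≱ x²<y² (*-mono-≤ y≤x y≤x))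
  ... | no y≰x = ≰⇒> y≰x

  ⌊√⌋-bounds : ∀ m → ⌊√ m ⌋ * ⌊√ m ⌋ ≤ m × m < suc ⌊√ m ⌋ * suc ⌊√ m ⌋
  ⌊√⌋-bounds zero = z≤n , s≤s z≤n
  ⌊√⌋-bounds (suc m) with suc ⌊√ m ⌋ * suc ⌊√ m ⌋ ≤ᵇ suc m in step
  ... | true = ≤ᵇ⇒≤ (suc s * suc s) (suc m) (subst T (sym step) _) ,
               <-≤-trans (s≤s (proj₂ (⌊√⌋-bounds m))) (*-self-mono-< (n<1+n (suc s)))
    where s = ⌊√ m ⌋
  ... | false = m≤n⇒m≤1+n (proj₁ (⌊√⌋-bounds m)) , ≰⇒> (λ le → subst T step (≤⇒≤ᵇ le))

  ⌈√⌉-upper : ∀ m → m ≤ ⌈√ m ⌉ * ⌈√ m ⌉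
  ⌈√⌉-upper m with ⌊√ m ⌋ * ⌊√ m ⌋ ≡ᵇ m in square
  ... | true = ≤-reflexive (sym (≡ᵇ⇒≡ _ m (subst T (sym square) _)))
  ... | false = <⇒≤ (proj₂ (⌊√⌋-bounds m))

  ⌈√⌉-least : ∀ m y → m ≤ y * y → ⌈√ m ⌉ ≤ y
  ⌈√⌉-least m y m≤y² with ⌊√ m ⌋ * ⌊√ m ⌋ ≡ᵇ m in square
  ... | true = *-self-cancel-≤ (≤-trans (≤-reflexive (≡ᵇ⇒≡ _ m (subst T (sym square) _))) m≤y²)
  ... | false = *-self-cancel-< (<-≤-trans (≤∧≢⇒< (proj₁ (⌊√⌋-bounds m)) (λ eq → subst T square (≡⇒≡ᵇ _ m eq))) m≤y²)

  cdiv-upper : ∀ a b → a ≤ cdiv a (suc b) * suc b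
  cdiv-upper a b = +-cancelʳ-≤ b a _ (begin
    a + b                                        ≡⟨ m≡m%n+[m/n]*n (a + b) (suc b) ⟩
    (a + b) % suc b + cdiv a (suc b) * suc b     ≤⟨ +-monoˡ-≤ _ (≤-pred (m%n<n (a + b) (suc b))) ⟩
    b + cdiv a (suc b) * suc b                   ≡⟨ +-comm b _ ⟩
    cdiv a (suc b) * suc b + b                   ∎)
    where open ≤-Reasoning

  cdiv-lower : ∀ a b → cdiv a (suc b) * suc b ≤ a + b
  cdiv-lower a b = m/n*n≤m (a + b) (suc b)

  4x[x+e]≤[2x+e]² : ∀ x e → 4 * (x * (x + e)) ≤ (x + (x + e)) * (x + (x + e))
  4x[x+e]≤[2x+e]² x e = subst (4 * (x * (x + e)) ≤_) (sym (expand x e)) (m≤m+n _ (e * e))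
    where
    expand : ∀ x e → (x + (x + e)) * (x + (x + e)) ≡ 4 * (x * (x + e)) + e * e
    expand = solve-∀

  4xy≤[x+y]² : ∀ x y → 4 * (x * y) ≤ (x + y) * (x + y)
  4xy≤[x+y]² x y with ≤-total x y
  ... | inj₁ x≤y = subst (λ y → 4 * (x * y) ≤ (x + y) * (x + y)) (m+[n∸m]≡n x≤y) (4x[x+e]≤[2x+e]² x (y ∸ x))
  ... | inj₂ y≤x = subst₂ _≤_ (cong (4 *_) (*-comm y x)) (cong (λ s → s * s) (+-comm y x))
                     (subst (λ x → 4 * (y * x) ≤ (y + x) * (y + x)) (m+[n∸m]≡n y≤x) (4x[x+e]≤[2x+e]² y (x ∸ y)))

  -- (x + y)² = 4xy + (x − y)², and here (x − y)² ≤ 1.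
  [x+y]²≤4xy+1-ordered : ∀ {x y} → x ≤ y → y ≤ suc x → (x + y) * (x + y) ≤ 4 * (x * y) + 1
  [x+y]²≤4xy+1-ordered {x} {y} x≤y y≤1+x = subst (λ y → (x + y) * (x + y) ≤ 4 * (x * y) + 1) (m+[n∸m]≡n x≤y)
    (near x (y ∸ x) (+-cancelˡ-≤ x (y ∸ x) 1 (subst₂ _≤_ (sym (m+[n∸m]≡n x≤y)) (+-comm 1 x) y≤1+x)))
    where
    near : ∀ x e → e ≤ 1 → (x + (x + e)) * (x + (x + e)) ≤ 4 * (x * (x + e)) + 1
    near x zero _ = subst (_≤ 4 * (x * (x + 0)) + 1) (sym (expand x)) (m≤m+n _ 1)
      where
      expand : ∀ x → (x + (x + 0)) * (x + (x + 0)) ≡ 4 * (x * (x + 0))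
      expand = solve-∀
    near x (suc zero) _ = ≤-reflexive (expand x)
      where
      expand : ∀ x → (x + (x + 1)) * (x + (x + 1)) ≡ 4 * (x * (x + 1)) + 1
      expand = solve-∀
    near x (suc (suc _)) (s≤s ())

  [x+y]²≤4xy+1 : ∀ x y → x ≤ suc y → y ≤ suc x → (x + y) * (x + y) ≤ 4 * (x * y) + 1
  [x+y]²≤4xy+1 x y x≤1+y y≤1+x with ≤-total x y
  ... | inj₁ x≤y = [x+y]²≤4xy+1-ordered x≤y y≤1+x
  ... | inj₂ y≤x = subst₂ _≤_ (cong (λ s → s * s) (+-comm y x)) (cong (λ s → 4 * s + 1) (*-comm y x))
                     ([x+y]²≤4xy+1-ordered y≤x x≤1+y)

  -- With f = ⌊√N⌋ and q = ⌈(N − f)/f⌉ one has qf < N ≤ (q + 1)f, which forces |q − f| ≤ 1; hence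
  -- (f + q)² ≤ 4qf + 1 < 4N ≤ 4st ≤ (s + t)² whenever N ≤ st.
  first-term-minimal : ∀ N f m ℓ → f * f ≤ N → N < suc f * suc f → 1 ≤ f → N ≤ suc m * suc ℓ →
    f ∸ 1 + cdiv (N ∸ f) f ≤ m + ℓ
  first-term-minimal N (suc f′) m ℓ f²≤N N<[f+1]² _ N≤st with f′ + cdiv (N ∸ suc f′) (suc f′) ≤? m + ℓ
  ... | yes bounded = bounded
  ... | no unbounded = ⊥-elim (<⇒≱ 4qf+1<4N 4N≤4qf+1)
    where
    f = suc f′
    q = cdiv (N ∸ f) f
    N∸f+f≡N : N ∸ f + f ≡ N
    N∸f+f≡N = m∸n+n≡m (≤-trans (m≤m*n f f) f²≤N)
    qf<N : q * f < N
    qf<N = begin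
      suc (q * f)          ≤⟨ s≤s (cdiv-lower (N ∸ f) f′) ⟩
      suc (N ∸ f + f′)     ≡⟨ +-suc (N ∸ f) f′ ⟨
      N ∸ f + f            ≡⟨ N∸f+f≡N ⟩
      N                    ∎
      where open ≤-Reasoning
    N≤qf+f : N ≤ q * f + f
    N≤qf+f = subst (_≤ q * f + f) N∸f+f≡N (+-monoˡ-≤ f (cdiv-upper (N ∸ f) f′))
    f≤1+q : f ≤ suc q
    f≤1+q = *-cancelʳ-≤ f (suc q) f (≤-trans f²≤N (subst (N ≤_) (+-comm (q * f) f) N≤qf+f))
    q≤1+f : q ≤ suc f
    q≤1+f = ≤-pred (*-cancelʳ-< f q (suc (suc f)) (<-≤-trans qf<N N≤[f+2]f))
      where
      N≤[f+2]f : N ≤ suc (suc f) * f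
      N≤[f+2]f = subst (N ≤_) (cong (f +_) (*-suc f f)) (≤-pred N<[f+1]²)
    s+t≤f+q : suc m + suc ℓ ≤ f + q
    s+t≤f+q = s≤s (subst (_≤ f′ + q) (sym (+-suc m ℓ)) (≰⇒> unbounded))
    4N≤4qf+1 : 4 * N ≤ 4 * (q * f) + 1
    4N≤4qf+1 = begin
      4 * N                                      ≤⟨ *-monoʳ-≤ 4 N≤st ⟩
      4 * (suc m * suc ℓ)                        ≤⟨ 4xy≤[x+y]² (suc m) (suc ℓ) ⟩
      (suc m + suc ℓ) * (suc m + suc ℓ)          ≤⟨ *-mono-≤ s+t≤f+q s+t≤f+q ⟩
      (f + q) * (f + q)                          ≤⟨ [x+y]²≤4xy+1 f q f≤1+q q≤1+f ⟩
      4 * (f * q) + 1                            ≡⟨ cong (λ x → 4 * x + 1) (*-comm f q) ⟩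
      4 * (q * f) + 1                            ∎
      where open ≤-Reasoning
    4qf+1<4N : 4 * (q * f) + 1 < 4 * N
    4qf+1<4N = begin-strict
      4 * (q * f) + 1                            <⟨ +-monoʳ-< (4 * (q * f)) (s≤s (s≤s z≤n)) ⟩
      4 * (q * f) + 4                            ≡⟨ +-comm (4 * (q * f)) 4 ⟩
      4 + 4 * (q * f)                            ≡⟨ *-suc 4 (q * f) ⟨
      4 * suc (q * f)                            ≤⟨ *-monoʳ-≤ 4 qf<N ⟩
      4 * N                                      ∎
      where open ≤-Reasoning

  first-term-attained : ∀ N f → 1 ≤ f → f ≤ N → N ≤ f * suc (cdiv (N ∸ f) f)
  first-term-attained N (suc f′) _ f≤N = begin
    N                       ≡⟨ m∸n+n≡m f≤N ⟨
    N ∸ f + f               ≤⟨ +-monoˡ-≤ f (cdiv-upper (N ∸ f) f′) ⟩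
    q * f + f               ≡⟨ +-comm (q * f) f ⟩
    f + q * f               ≡⟨ cong (f +_) (*-comm q f) ⟩
    f + f * q               ≡⟨ *-suc f q ⟨
    f * suc q               ∎
    where
    open ≤-Reasoning
    f = suc f′
    q = cdiv (N ∸ f) f

  second-term-attained : ∀ N c c′ → 1 ≤ c′ → c′ ≤ c → N ≤ c * suc (cdiv (N ∸ c) c′)
  second-term-attained N c (suc c₀′) _ c′≤c = begin
    N                       ≤⟨ m≤n+m∸n N c ⟩
    c + (N ∸ c)             ≤⟨ +-monoʳ-≤ c (cdiv-upper (N ∸ c) c₀′) ⟩
    c + q * suc c₀′         ≤⟨ +-monoʳ-≤ c (*-monoʳ-≤ q c′≤c) ⟩
    c + q * c               ≡⟨ cong (c +_) (*-comm q c) ⟩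
    c + c * q               ≡⟨ *-suc c q ⟨
    c * suc q               ∎
    where
    open ≤-Reasoning
    q = cdiv (N ∸ c) (suc c₀′)

  square-root-pos : ∀ {m y} → 1 ≤ m → m ≤ y * y → 1 ≤ y
  square-root-pos {y = zero} 1≤m m≤0 = ⊥-elim (<⇒≱ 1≤m m≤0)
  square-root-pos {y = suc _} _ _ = s≤s z≤n

  ⌊√⌋-pos : ∀ m → 1 ≤ m → 1 ≤ ⌊√ m ⌋
  ⌊√⌋-pos m 1≤m with ⌊√ m ⌋ | proj₂ (⌊√⌋-bounds m)
  ... | zero | m<1 = ⊥-elim (<⇒≱ m<1 1≤m)
  ... | suc _ | _ = s≤s z≤n

  1+[m∸1]≡m : ∀ {m} → 1 ≤ m → suc (m ∸ 1) ≡ m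
  1+[m∸1]≡m = m+[n∸m]≡n

  φ-minimal : ∀ n m ℓ → 1 ≤ n → suc n ≤ suc m * suc ℓ → φ n ≤ m + ℓ
  φ-minimal n m ℓ 1≤n fits = ≤-trans (m⊓n≤m _ _)
    (first-term-minimal (n + 1) ⌊√ (n + 1) ⌋ m ℓ (proj₁ (⌊√⌋-bounds (n + 1))) (proj₂ (⌊√⌋-bounds (n + 1)))
      (⌊√⌋-pos (n + 1) (m≤n+m 1 n)) (subst (_≤ suc m * suc ℓ) (+-comm 1 n) fits))

  first-term-affordable : ∀ n → Affordable n (⌊√ (n + 1) ⌋ ∸ 1 + cdiv (n + 1 ∸ ⌊√ (n + 1) ⌋) ⌊√ (n + 1) ⌋)
  first-term-affordable n = f ∸ 1 , cdiv (N ∸ f) f , ≤-refl ,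
    subst₂ _≤_ (+-comm n 1) (cong (_* suc (cdiv (N ∸ f) f)) (sym (1+[m∸1]≡m 1≤f)))
      (first-term-attained N f 1≤f (≤-trans (m≤m*n f f {{>-nonZero 1≤f}}) (proj₁ (⌊√⌋-bounds N))))
    where
    N = n + 1
    f = ⌊√ N ⌋
    1≤f : 1 ≤ f
    1≤f = ⌊√⌋-pos N (m≤n+m 1 n)

  second-term-affordable : ∀ n → 1 ≤ n → Affordable n (⌈√ (n + 1) ⌉ ∸ 1 + cdiv (n + 1 ∸ ⌈√ (n + 1) ⌉) ⌈√ n ⌉)
  second-term-affordable n 1≤n = c ∸ 1 , cdiv (N ∸ c) c′ , ≤-refl ,
    subst₂ _≤_ (+-comm n 1) (cong (_* suc (cdiv (N ∸ c) c′)) (sym (1+[m∸1]≡m 1≤c)))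
      (second-term-attained N c c′ (square-root-pos 1≤n (⌈√⌉-upper n)) c′≤c)
    where
    N = n + 1
    c = ⌈√ N ⌉
    c′ = ⌈√ n ⌉
    1≤c : 1 ≤ c
    1≤c = square-root-pos (m≤n+m 1 n) (⌈√⌉-upper N)
    c′≤c : c′ ≤ c
    c′≤c = ⌈√⌉-least n c (≤-trans (m≤m+n n 1) (⌈√⌉-upper N))

  φ-attained : ∀ n → 1 ≤ n → Affordable n (φ n)
  φ-attained n 1≤n with ⊓-sel (⌊√ (n + 1) ⌋ ∸ 1 + cdiv (n + 1 ∸ ⌊√ (n + 1) ⌋) ⌊√ (n + 1) ⌋)
                              (⌈√ (n + 1) ⌉ ∸ 1 + cdiv (n + 1 ∸ ⌈√ (n + 1) ⌉) ⌈√ n ⌉)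
  ... | inj₁ φ≡first = subst (Affordable n) (sym φ≡first) (first-term-affordable n)
  ... | inj₂ φ≡second = subst (Affordable n) (sym φ≡second) (second-term-affordable n 1≤n)

  affordable⇒φ≤ : ∀ {n d} → 1 ≤ n → Affordable n d → φ n ≤ d
  affordable⇒φ≤ {n} 1≤n (m , ℓ , budget , fits) = ≤-trans (φ-minimal n m ℓ 1≤n fits) budget

  φ≤⇒affordable : ∀ {n d} → 1 ≤ n → φ n ≤ d → Affordable n d
  φ≤⇒affordable {n} 1≤n φ≤d = affordable-mono φ≤d (φ-attained n 1≤n)

module IntegerSums where

  open import Data.Nat as ℕ using (ℕ; zero; suc; z≤n; s≤s)
  import Data.Nat.Properties as ℕ
  open import Data.Integer using (ℤ; +_; _+_; _-_; -_; _*_; _≤_; _⊔_; 0ℤ; 1ℤ; +≤+)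
  open import Data.Integer.Properties
  open import Algebra.Properties.CommutativeSemigroup +-commutativeSemigroup
    using () renaming (interchange to +-interchange)

  𝟙 : Bool → ℤ
  𝟙 true = 1ℤ
  𝟙 false = 0ℤ

  𝟙-nonneg : ∀ b → 0ℤ ≤ 𝟙 b
  𝟙-nonneg true = +≤+ z≤n
  𝟙-nonneg false = +≤+ z≤n

  δ : ℕ → ℕ → ℤ
  δ j v = 𝟙 (does (v ℕ.≟ j))

  δ-nonneg : ∀ j v → 0ℤ ≤ δ j v
  δ-nonneg j v = 𝟙-nonneg (does (v ℕ.≟ j))

  δ-diag : ∀ j → δ j j ≡ 1ℤ
  δ-diag j = cong 𝟙 (dec-true (j ℕ.≟ j) refl)

  δ-off : ∀ {v j} → v ≢ j → δ j v ≡ 0ℤ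
  δ-off {v} {j} v≢j = cong 𝟙 (dec-false (v ℕ.≟ j) v≢j)

  ∑ : ℕ → (ℕ → ℤ) → ℤ
  ∑ zero f = 0ℤ
  ∑ (suc m) f = ∑ m f + f (suc m)

  ∑-cong : ∀ m {f g : ℕ → ℤ} → (∀ v → 1 ℕ.≤ v → v ℕ.≤ m → f v ≡ g v) → ∑ m f ≡ ∑ m g
  ∑-cong zero h = refl
  ∑-cong (suc m) h = cong₂ _+_ (∑-cong m (λ v 1≤v v≤m → h v 1≤v (ℕ.m≤n⇒m≤1+n v≤m))) (h (suc m) (s≤s z≤n) ℕ.≤-refl)

  ∑-zero : ∀ m → ∑ m (λ _ → 0ℤ) ≡ 0ℤ
  ∑-zero zero = refl
  ∑-zero (suc m) = cong (_+ 0ℤ) (∑-zero m)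

  ∑-+ : ∀ m (f g : ℕ → ℤ) → ∑ m (λ v → f v + g v) ≡ ∑ m f + ∑ m g
  ∑-+ zero f g = refl
  ∑-+ (suc m) f g = trans (cong (_+ (f (suc m) + g (suc m))) (∑-+ m f g)) (+-interchange (∑ m f) (∑ m g) _ _)

  ∑-* : ∀ m c (f : ℕ → ℤ) → ∑ m (λ v → c * f v) ≡ c * ∑ m f
  ∑-* zero c f = sym (*-zeroʳ c)
  ∑-* (suc m) c f = trans (cong (_+ c * f (suc m)) (∑-* m c f)) (sym (*-distribˡ-+ c (∑ m f) (f (suc m))))

  ∑-neg : ∀ m (f : ℕ → ℤ) → ∑ m (λ v → - f v) ≡ - ∑ m f
  ∑-neg zero f = refl
  ∑-neg (suc m) f = trans (cong (_+ - f (suc m)) (∑-neg m f)) (sym (neg-distrib-+ (∑ m f) (f (suc m))))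

  ∑-- : ∀ m (f g : ℕ → ℤ) → ∑ m (λ v → f v - g v) ≡ ∑ m f - ∑ m g
  ∑-- m f g = trans (∑-+ m f (λ v → - g v)) (cong (λ s → ∑ m f + s) (∑-neg m g))

  ∑-mono : ∀ m {f g : ℕ → ℤ} → (∀ v → 1 ℕ.≤ v → v ℕ.≤ m → f v ≤ g v) → ∑ m f ≤ ∑ m g
  ∑-mono zero h = ≤-refl
  ∑-mono (suc m) h = +-mono-≤ (∑-mono m (λ v 1≤v v≤m → h v 1≤v (ℕ.m≤n⇒m≤1+n v≤m))) (h (suc m) (s≤s z≤n) ℕ.≤-refl)

  ∑-nonneg : ∀ m {g : ℕ → ℤ} → (∀ v → 1 ℕ.≤ v → v ℕ.≤ m → 0ℤ ≤ g v) → 0ℤ ≤ ∑ m g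
  ∑-nonneg m {g} h = subst (_≤ ∑ m g) (∑-zero m) (∑-mono m h)

  ∑-last : ∀ m (f : ℕ → ℤ) → (∀ v → 1 ℕ.≤ v → v ℕ.≤ m → f v ≡ 0ℤ) → ∑ (suc m) f ≡ f (suc m)
  ∑-last m f h = trans (cong (_+ f (suc m)) (trans (∑-cong m h) (∑-zero m))) (+-identityˡ _)

  ∑-δ : ∀ (c : ℕ → ℤ) k m → 1 ℕ.≤ k → k ℕ.≤ m → ∑ m (λ v → c v * δ k v) ≡ c k
  ∑-δ c k zero 1≤k k≤0 = ⊥-elim (ℕ.<⇒≱ 1≤k k≤0)
  ∑-δ c k (suc m) 1≤k k≤m with ℕ.m≤n⇒m<n∨m≡n k≤m
  ... | inj₁ k<1+m = begin
    ∑ m (λ v → c v * δ k v) + c (suc m) * δ k (suc m) ≡⟨ cong₂ _+_ (∑-δ c k m 1≤k (ℕ.≤-pred k<1+m))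
                                                               (cong (c (suc m) *_) (δ-off (ℕ.>⇒≢ k<1+m))) ⟩
    c k + c (suc m) * 0ℤ                               ≡⟨ cong (λ s → c k + s) (*-zeroʳ (c (suc m))) ⟩
    c k + 0ℤ                                           ≡⟨ +-identityʳ (c k) ⟩
    c k                                                ∎
    where open ≡-Reasoning
  ... | inj₂ refl = begin
    ∑ m (λ v → c v * δ k v) + c k * δ k k ≡⟨ cong₂ _+_ (trans (∑-cong m (λ v _ v≤m →
                                                 trans (cong (c v *_) (δ-off (ℕ.<⇒≢ (s≤s v≤m)))) (*-zeroʳ (c v))))
                                               (∑-zero m))
                                             (cong (c k *_) (δ-diag k)) ⟩
    0ℤ + c k * 1ℤ                         ≡⟨ trans (+-identityˡ _) (*-identityʳ (c k)) ⟩
    c k                                   ∎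
    where open ≡-Reasoning

  ∑-extend : ∀ {m m′} {g : ℕ → ℤ} → m ℕ.≤ m′ → (∀ v → 1 ℕ.≤ v → v ℕ.≤ m′ → 0ℤ ≤ g v) → ∑ m g ≤ ∑ m′ g
  ∑-extend {m} {zero} z≤n _ = ≤-refl
  ∑-extend {m} {suc m′} {g} m≤m′ h with ℕ.m≤n⇒m<n∨m≡n m≤m′
  ... | inj₂ refl = ≤-refl
  ... | inj₁ m<1+m′ = begin
    ∑ m g                    ≤⟨ ∑-extend (ℕ.≤-pred m<1+m′) (λ v 1≤v v≤m′ → h v 1≤v (ℕ.m≤n⇒m≤1+n v≤m′)) ⟩
    ∑ m′ g                   ≡⟨ +-identityʳ _ ⟨
    ∑ m′ g + 0ℤ              ≤⟨ +-monoʳ-≤ (∑ m′ g) (h (suc m′) (s≤s z≤n) ℕ.≤-refl) ⟩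
    ∑ m′ g + g (suc m′)      ∎
    where open ≤-Reasoning

  ∑-term : ∀ m {g : ℕ → ℤ} → (∀ v → 1 ℕ.≤ v → v ℕ.≤ m → 0ℤ ≤ g v) → ∀ k → 1 ℕ.≤ k → k ℕ.≤ m → g k ≤ ∑ m g
  ∑-term m {g} h (suc k) _ k<m = begin
    g (suc k)                 ≡⟨ +-identityˡ _ ⟨
    0ℤ + g (suc k)            ≤⟨ +-monoˡ-≤ (g (suc k)) (∑-nonneg k (λ v 1≤v v≤k → h v 1≤v (ℕ.≤-trans (ℕ.m≤n⇒m≤1+n v≤k) k<m))) ⟩
    ∑ (suc k) g               ≤⟨ ∑-extend k<m h ⟩
    ∑ m g                     ∎
    where open ≤-Reasoning

  ∑-run : ∀ i₀ ℓ {g : ℕ → ℤ} → (∀ v → 1 ℕ.≤ v → v ℕ.≤ i₀ ℕ.+ ℓ → 0ℤ ≤ g v) →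
    (∀ t → t ℕ.< ℓ → 1ℤ ≤ g (suc (i₀ ℕ.+ t))) → + ℓ ≤ ∑ (i₀ ℕ.+ ℓ) g
  ∑-run i₀ zero {g} g≥0 _ = ∑-nonneg (i₀ ℕ.+ 0) g≥0
  ∑-run i₀ (suc ℓ) {g} g≥0 run≥1 = begin
    + suc ℓ                                  ≡⟨ cong +_ (ℕ.+-comm 1 ℓ) ⟩
    + ℓ + 1ℤ                                 ≤⟨ +-mono-≤ (∑-run i₀ ℓ (λ v 1≤v v≤ → g≥0 v 1≤v (ℕ.≤-trans v≤ i₀+ℓ≤))
                                                          (λ t t<ℓ → run≥1 t (ℕ.m≤n⇒m≤1+n t<ℓ)))
                                                  (run≥1 ℓ ℕ.≤-refl) ⟩
    ∑ (i₀ ℕ.+ ℓ) g + g (suc (i₀ ℕ.+ ℓ))      ≡⟨ cong (λ m → ∑ m g) (ℕ.+-suc i₀ ℓ) ⟨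
    ∑ (i₀ ℕ.+ suc ℓ) g                       ∎
    where
    open ≤-Reasoning
    i₀+ℓ≤ : i₀ ℕ.+ ℓ ℕ.≤ i₀ ℕ.+ suc ℓ
    i₀+ℓ≤ = ℕ.+-monoʳ-≤ i₀ (ℕ.n≤1+n ℓ)

  -- the maximum of f over 1 .. m, read as f 1 when m = 0
  maximum : ℕ → (ℕ → ℤ) → ℤ
  maximum zero f = f 1
  maximum (suc m) f = maximum m f ⊔ f (suc m)

  maximum-upper : ∀ m f v → 1 ℕ.≤ v → v ℕ.≤ m → f v ≤ maximum m f
  maximum-upper zero f v 1≤v v≤0 = ⊥-elim (ℕ.<⇒≱ 1≤v v≤0)
  maximum-upper (suc m) f v 1≤v v≤1+m with ℕ.m≤n⇒m<n∨m≡n v≤1+m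
  ... | inj₁ v<1+m = ≤-trans (maximum-upper m f v 1≤v (ℕ.≤-pred v<1+m)) (i≤i⊔j (maximum m f) (f (suc m)))
  ... | inj₂ refl = i≤j⊔i (maximum m f) (f (suc m))

  maximum-attained : ∀ m f → Σ[ v ∈ ℕ ] (1 ℕ.≤ v × v ℕ.≤ suc m × f v ≡ maximum (suc m) f)
  maximum-attained zero f = 1 , ℕ.≤-refl , ℕ.≤-refl , sym (⊔-idem (f 1))
  maximum-attained (suc m) f with ⊔-sel (maximum (suc m) f) (f (suc (suc m)))
  ... | inj₁ max≡ = let (v , 1≤v , v≤ , fv≡) = maximum-attained m f in v , 1≤v , ℕ.m≤n⇒m≤1+n v≤ , trans fv≡ (sym max≡)
  ... | inj₂ max≡ = suc (suc m) , s≤s z≤n , ℕ.≤-refl , sym max≡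

module FanGraph (p : ℕ) where

  open import Data.Nat as ℕ using (zero; suc; pred; z≤n; s≤s)
  import Data.Nat.Properties as ℕ
  open import Data.Integer using (ℤ; +_; _+_; _-_; -_; _*_; _≤_; _<_; 0ℤ; 1ℤ; +≤+; _≟_; ∣_∣)
  open import Data.Integer.Properties
  open import Data.Integer.Tactic.RingSolver using (solve-∀)
  open import Data.Integer.Divisibility.Signed
    using (_∣_; divides; ∣-refl; ∣n⇒∣m*n; ∣m⇒∣m*n; ∣m+n∣m⇒∣n; ∣m∣n⇒∣m+n; ∣m∣n⇒∣m-n; ∣m⇒∣-m; ∣ᵤ⇒∣; ∣⇒∣ᵤ)
  open IntegerSums
  open OddFibonacci
  open Splitting using (Affordable; affordable-with-gap)

  n : ℕ
  n = suc p

  when : Bool → ℤ → ℤ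
  when true x = x
  when false _ = 0ℤ

  when-𝟙 : ∀ b x → when b x ≡ 𝟙 b * x
  when-𝟙 true x = sym (*-identityˡ x)
  when-𝟙 false x = sym (*-zeroˡ x)

  -- The reduced Laplacian of the fan. Divisors and firing scripts are functions ℕ → ℤ of which only
  -- the values at 1 .. n matter.
  Δ : (ℕ → ℤ) → ℕ → ℤ
  Δ g v = g v + when (does (1 ℕ.<? v)) (g v - g (pred v)) + when (does (v ℕ.<? n)) (g v - g (suc v))

  a : ℕ → ℤ
  a v = + oddFib v

  M : ℤ
  M = + fib (2 ℕ.* n)

  Δa-interior : ∀ v → 1 ℕ.≤ v → v ℕ.< n → Δ a v ≡ 0ℤ
  Δa-interior (suc zero) _ 1<n rewrite dec-true (1 ℕ.<? n) 1<n = refl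
  Δa-interior (suc (suc w)) _ v<n rewrite dec-true (suc (suc w) ℕ.<? n) v<n
                                   | oddFib-suc w | oddFib-suc (suc w) | oddFib-suc (suc (suc w)) =
    three-term (+ x) (+ y) (+ z)
      (trans (sym (pos-+ y z)) (trans (cong +_ (trans (ℕ.+-comm y z) (fib-odd-recurrence w))) (pos-* 3 x)))
    where
    x = fib (suc (double (suc w)))
    y = fib (suc (double w))
    z = fib (suc (double (suc (suc w))))
    three-term : ∀ x y z → y + z ≡ + 3 * x → x + (x - y) + (x - z) ≡ 0ℤ
    three-term x y z y+z≡3x = trans (regroup x y z) (trans (cong (λ s → + 3 * x - s) y+z≡3x) (+-inverseʳ (+ 3 * x)))
      where
      regroup : ∀ x y z → x + (x - y) + (x - z) ≡ + 3 * x - (y + z)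
      regroup = solve-∀

  Δa-end : Δ a n ≡ M
  Δa-end = trans (Δa-suc p refl) (cong (λ m → + fib m) (sym (2*-double n)))
    where
    Δa-suc : ∀ q → q ≡ p → Δ a (suc q) ≡ + fib (double (suc q))
    Δa-suc zero refl = refl
    Δa-suc (suc w) refl rewrite dec-false (suc (suc w) ℕ.<? suc (suc w)) (ℕ.<-irrefl refl)
                              | oddFib-suc w | oddFib-suc (suc w) =
      two-term (+ x) (+ y) (+ z) (trans (sym (pos-* 2 x)) (trans (cong +_ (fib-even-from-odd w)) (pos-+ y z)))
      where
      x = fib (suc (double (suc w)))
      y = fib (suc (double w))
      z = fib (double (suc (suc w)))
      two-term : ∀ x y z → + 2 * x ≡ y + z → x + (x - y) + 0ℤ ≡ z
      two-term x y z 2x≡y+z = trans (regroup x y) (trans (cong (_- y) 2x≡y+z) (cancel y z))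
        where
        regroup : ∀ x y → x + (x - y) + 0ℤ ≡ + 2 * x - y
        regroup = solve-∀
        cancel : ∀ y z → y + z - y ≡ z
        cancel = solve-∀

  Δ-𝟙 : ∀ g v → Δ g v ≡ g v + 𝟙 (does (1 ℕ.<? v)) * (g v - g (pred v)) + 𝟙 (does (v ℕ.<? n)) * (g v - g (suc v))
  Δ-𝟙 g v = cong₂ (λ s t → g v + s + t) (when-𝟙 (does (1 ℕ.<? v)) _) (when-𝟙 (does (v ℕ.<? n)) _)

  Δ-const : ∀ c v → Δ (λ _ → c) v ≡ c
  Δ-const c v rewrite Δ-𝟙 (λ _ → c) v = identity c (𝟙 (does (1 ℕ.<? v))) (𝟙 (does (v ℕ.<? n)))
    where
    identity : ∀ c s t → c + s * (c - c) + t * (c - c) ≡ c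
    identity = solve-∀

  Δ-* : ∀ c (h : ℕ → ℤ) v → Δ (λ u → c * h u) v ≡ c * Δ h v
  Δ-* c h v rewrite Δ-𝟙 (λ u → c * h u) v | Δ-𝟙 h v =
    identity (𝟙 (does (1 ℕ.<? v))) (𝟙 (does (v ℕ.<? n))) c (h v) (h (pred v)) (h (suc v))
    where
    identity : ∀ s t c y y₀ y₁ →
      c * y + s * (c * y - c * y₀) + t * (c * y - c * y₁) ≡ c * (y + s * (y - y₀) + t * (y - y₁))
    identity = solve-∀

  Δ-neg : ∀ (h : ℕ → ℤ) v → Δ (λ u → - h u) v ≡ - Δ h v
  Δ-neg h v rewrite Δ-𝟙 (λ u → - h u) v | Δ-𝟙 h v =
    identity (𝟙 (does (1 ℕ.<? v))) (𝟙 (does (v ℕ.<? n))) (h v) (h (pred v)) (h (suc v))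
    where
    identity : ∀ s t y y₀ y₁ → - y + s * (- y - - y₀) + t * (- y - - y₁) ≡ - (y + s * (y - y₀) + t * (y - y₁))
    identity = solve-∀

  Δ-sub : ∀ (f h : ℕ → ℤ) v → Δ (λ u → f u - h u) v ≡ Δ f v - Δ h v
  Δ-sub f h v rewrite Δ-𝟙 (λ u → f u - h u) v | Δ-𝟙 f v | Δ-𝟙 h v =
    identity (𝟙 (does (1 ℕ.<? v))) (𝟙 (does (v ℕ.<? n))) (f v) (f (pred v)) (f (suc v)) (h v) (h (pred v)) (h (suc v))
    where
    identity : ∀ s t x x₀ x₁ y y₀ y₁ →
      (x - y) + s * ((x - y) - (x₀ - y₀)) + t * ((x - y) - (x₁ - y₁))
        ≡ (x + s * (x - x₀) + t * (x - x₁)) - (y + s * (y - y₀) + t * (y - y₁))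
    identity = solve-∀

  Δ-local : ∀ g v → g (pred v) ≡ 0ℤ → g v ≡ 0ℤ → g (suc v) ≡ 0ℤ → Δ g v ≡ 0ℤ
  Δ-local g v g₀ g₁ g₂ rewrite Δ-𝟙 g v | g₀ | g₁ | g₂ = identity (𝟙 (does (1 ℕ.<? v))) (𝟙 (does (v ℕ.<? n)))
    where
    identity : ∀ s t → 0ℤ + s * (0ℤ - 0ℤ) + t * (0ℤ - 0ℤ) ≡ 0ℤ
    identity = solve-∀

  private
    symmetric-first : ∀ b w₁ w₂ g₁ g₂ →
      0ℤ + w₁ * (g₁ + 0ℤ + when b (g₁ - g₂)) ≡ 0ℤ + g₁ * (w₁ + 0ℤ + when b (w₁ - w₂)) + when b (g₁ * w₂ - w₁ * g₂)
    symmetric-first true = identity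
      where
      identity : ∀ w₁ w₂ g₁ g₂ →
        0ℤ + w₁ * (g₁ + 0ℤ + (g₁ - g₂)) ≡ 0ℤ + g₁ * (w₁ + 0ℤ + (w₁ - w₂)) + (g₁ * w₂ - w₁ * g₂)
      identity = solve-∀
    symmetric-first false = identity
      where
      identity : ∀ w₁ w₂ g₁ g₂ → 0ℤ + w₁ * (g₁ + 0ℤ + 0ℤ) ≡ 0ℤ + g₁ * (w₁ + 0ℤ + 0ℤ) + 0ℤ
      identity = solve-∀

    symmetric-next : ∀ b X Y w₀ w₁ w₂ g₀ g₁ g₂ → X ≡ Y + (g₀ * w₁ - w₀ * g₁) →
      X + w₁ * (g₁ + (g₁ - g₀) + when b (g₁ - g₂))
        ≡ (Y + g₁ * (w₁ + (w₁ - w₀) + when b (w₁ - w₂))) + when b (g₁ * w₂ - w₁ * g₂)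
    symmetric-next true X Y w₀ w₁ w₂ g₀ g₁ g₂ refl = identity Y w₀ w₁ w₂ g₀ g₁ g₂
      where
      identity : ∀ Y w₀ w₁ w₂ g₀ g₁ g₂ →
        Y + (g₀ * w₁ - w₀ * g₁) + w₁ * (g₁ + (g₁ - g₀) + (g₁ - g₂))
          ≡ (Y + g₁ * (w₁ + (w₁ - w₀) + (w₁ - w₂))) + (g₁ * w₂ - w₁ * g₂)
      identity = solve-∀
    symmetric-next false X Y w₀ w₁ w₂ g₀ g₁ g₂ refl = identity Y w₀ w₁ w₂ g₀ g₁ g₂
      where
      identity : ∀ Y w₀ w₁ w₂ g₀ g₁ g₂ →
        Y + (g₀ * w₁ - w₀ * g₁) + w₁ * (g₁ + (g₁ - g₀) + 0ℤ) ≡ (Y + g₁ * (w₁ + (w₁ - w₀) + 0ℤ)) + 0ℤ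
      identity = solve-∀

  -- Summation by parts on 1..m+1: what is left is the flux across the edge m+1 — m+2.
  Δ-symmetric-upTo : ∀ (w g : ℕ → ℤ) m → suc m ℕ.≤ n →
    ∑ (suc m) (λ v → w v * Δ g v)
      ≡ ∑ (suc m) (λ v → g v * Δ w v)
        + when (does (suc m ℕ.<? n)) (g (suc m) * w (suc (suc m)) - w (suc m) * g (suc (suc m)))
  Δ-symmetric-upTo w g zero _ = symmetric-first (does (1 ℕ.<? n)) (w 1) (w 2) (g 1) (g 2)
  Δ-symmetric-upTo w g (suc m) m+2≤n =
    symmetric-next (does (suc (suc m) ℕ.<? n)) _ (∑ (suc m) (λ v → g v * Δ w v))
      (w (suc m)) (w (suc (suc m))) (w (suc (suc (suc m)))) (g (suc m)) (g (suc (suc m))) (g (suc (suc (suc m))))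
      (trans (Δ-symmetric-upTo w g m (ℕ.≤-trans (ℕ.n≤1+n _) m+2≤n))
             (cong (λ b → ∑ (suc m) (λ v → g v * Δ w v) + when b (g (suc m) * w (suc (suc m)) - w (suc m) * g (suc (suc m))))
                   (dec-true (suc m ℕ.<? n) m+2≤n)))

  Δ-symmetric : ∀ (w g : ℕ → ℤ) → ∑ n (λ v → w v * Δ g v) ≡ ∑ n (λ v → g v * Δ w v)
  Δ-symmetric w g = begin
    ∑ n (λ v → w v * Δ g v)                           ≡⟨ Δ-symmetric-upTo w g p ℕ.≤-refl ⟩
    ∑ n (λ v → g v * Δ w v) + when (does (n ℕ.<? n)) flux ≡⟨ cong (λ b → ∑ n (λ v → g v * Δ w v) + when b flux)
                                                               (dec-false (n ℕ.<? n) (ℕ.<-irrefl refl)) ⟩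
    ∑ n (λ v → g v * Δ w v) + 0ℤ                      ≡⟨ +-identityʳ _ ⟩
    ∑ n (λ v → g v * Δ w v)                           ∎
    where
    open ≡-Reasoning
    flux = g n * w (suc n) - w n * g (suc n)

  deg : (ℕ → ℤ) → ℤ
  deg g = ∑ n g

  weight : (ℕ → ℤ) → ℤ
  weight g = ∑ n (λ v → a v * g v)

  deg-Δ : ∀ g → deg (Δ g) ≡ deg g
  deg-Δ g = begin
    ∑ n (Δ g)                            ≡⟨ ∑-cong n (λ v _ _ → sym (*-identityˡ (Δ g v))) ⟩
    ∑ n (λ v → 1ℤ * Δ g v)               ≡⟨ Δ-symmetric (λ _ → 1ℤ) g ⟩
    ∑ n (λ v → g v * Δ (λ _ → 1ℤ) v)     ≡⟨ ∑-cong n (λ v _ _ → trans (cong (g v *_) (Δ-const 1ℤ v)) (*-identityʳ (g v))) ⟩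
    ∑ n g                                ∎
    where open ≡-Reasoning

  weight-Δ : ∀ g → weight (Δ g) ≡ g n * M
  weight-Δ g = begin
    weight (Δ g)                     ≡⟨ Δ-symmetric a g ⟩
    ∑ n (λ v → g v * Δ a v)          ≡⟨ ∑-last p (λ v → g v * Δ a v) (λ v 1≤v v≤p →
                                          trans (cong (g v *_) (Δa-interior v 1≤v (s≤s v≤p))) (*-zeroʳ (g v))) ⟩
    g n * Δ a n                      ≡⟨ cong (g n *_) Δa-end ⟩
    g n * M                          ∎
    where open ≡-Reasoning

  weight-+ : ∀ (f h : ℕ → ℤ) → weight (λ v → f v + h v) ≡ weight f + weight h
  weight-+ f h = trans (∑-cong n (λ v _ _ → *-distribˡ-+ (a v) (f v) (h v))) (∑-+ n (λ v → a v * f v) (λ v → a v * h v))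

  weight-* : ∀ c (h : ℕ → ℤ) → weight (λ v → c * h v) ≡ c * weight h
  weight-* c h = trans (∑-cong n (λ v _ _ → x*[c*y]≡c*[x*y] (a v) c (h v))) (∑-* n c (λ v → a v * h v))
    where
    x*[c*y]≡c*[x*y] : ∀ x c y → x * (c * y) ≡ c * (x * y)
    x*[c*y]≡c*[x*y] = solve-∀

  weight-- : ∀ (f h : ℕ → ℤ) → weight (λ v → f v - h v) ≡ weight f - weight h
  weight-- f h = trans (∑-cong n (λ v _ _ → distribute (a v) (f v) (h v))) (∑-- n (λ v → a v * f v) (λ v → a v * h v))
    where
    distribute : ∀ x y z → x * (y - z) ≡ x * y - x * z
    distribute = solve-∀

  -- By Cassini, F_{2n−1}² = F_{2n} F_{2n−2} + 1.
  a-end-unit : ∀ x → M ∣ a n * x → M ∣ x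
  a-end-unit x M∣aₙx = ∣m+n∣m⇒∣n {M} {M * (F * x)} {x} M∣MFx+x (∣m⇒∣m*n (F * x) (∣-refl {M}))
    where
    F = + fib (double p)
    A = + fib (suc (double p))
    M≡ : M ≡ + fib (double n)
    M≡ = cong (λ m → + fib m) (2*-double n)
    AA≡MF+1 : A * A ≡ M * F + 1ℤ
    AA≡MF+1 = begin
      A * A                                                   ≡⟨ pos-* (fib (suc (double p))) (fib (suc (double p))) ⟨
      + (fib (suc (double p)) ℕ.* fib (suc (double p)))       ≡⟨ cong +_ (cassini-odd p) ⟩
      + (fib (double n) ℕ.* fib (double p) ℕ.+ 1)             ≡⟨ pos-+ (fib (double n) ℕ.* fib (double p)) 1 ⟩
      + (fib (double n) ℕ.* fib (double p)) + 1ℤ              ≡⟨ cong (_+ 1ℤ) (pos-* (fib (double n)) (fib (double p))) ⟩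
      + fib (double n) * F + 1ℤ                               ≡⟨ cong (λ m → m * F + 1ℤ) M≡ ⟨
      M * F + 1ℤ                                              ∎
      where open ≡-Reasoning
    M∣MFx+x : M ∣ M * (F * x) + x
    M∣MFx+x = subst (M ∣_) (begin
      A * (A * x)        ≡⟨ *-assoc A A x ⟨
      (A * A) * x        ≡⟨ cong (_* x) AA≡MF+1 ⟩
      (M * F + 1ℤ) * x   ≡⟨ distribute M F x ⟩
      M * (F * x) + x    ∎) (∣n⇒∣m*n A (subst (λ c → M ∣ c * x) (cong +_ (oddFib-suc p)) M∣aₙx))
      where
      open ≡-Reasoning
      distribute : ∀ m f x → (m * f + 1ℤ) * x ≡ m * (f * x) + x
      distribute = solve-∀

  Principal : (ℕ → ℤ) → Set
  Principal b = Σ[ f ∈ (ℕ → ℤ) ] (∀ v → 1 ℕ.≤ v → v ℕ.≤ n → Δ f v ≡ b v)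

  end-multiple-principal : ∀ b q → (∀ v → 1 ℕ.≤ v → v ℕ.≤ p → b v ≡ 0ℤ) → b n ≡ q * M → Principal b
  end-multiple-principal b q vanish bₙ≡qM = (λ u → q * a u) , solves
    where
    solves : ∀ v → 1 ℕ.≤ v → v ℕ.≤ n → Δ (λ u → q * a u) v ≡ b v
    solves v 1≤v v≤n with ℕ.m≤n⇒m<n∨m≡n v≤n
    ... | inj₁ v<n = trans (Δ-* q a v) (trans (cong (q *_) (Δa-interior v 1≤v v<n))
                       (trans (*-zeroʳ q) (sym (vanish v 1≤v (ℕ.≤-pred v<n)))))
    ... | inj₂ refl = trans (Δ-* q a n) (trans (cong (q *_) Δa-end) (sym bₙ≡qM))

  principal-at-end : ∀ b → (∀ v → 1 ℕ.≤ v → v ℕ.≤ p → b v ≡ 0ℤ) → M ∣ weight b → Principal b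
  principal-at-end b vanish M∣wb with a-end-unit (b n) (subst (M ∣_) weight≡ M∣wb)
    where
    weight≡ : weight b ≡ a n * b n
    weight≡ = ∑-last p (λ v → a v * b v) (λ v 1≤v v≤p → trans (cong (a v *_) (vanish v 1≤v v≤p)) (*-zeroʳ (a v)))
  ... | divides q bₙ≡qM = end-multiple-principal b q vanish bₙ≡qM

  principal-shift : ∀ b c j → Principal (λ v → b v + c * Δ (δ j) v) → Principal b
  principal-shift b c j (f , Δf≡) = (λ v → f v - c * δ j v) , solves
    where
    solves : ∀ v → 1 ℕ.≤ v → v ℕ.≤ n → Δ (λ v → f v - c * δ j v) v ≡ b v
    solves v 1≤v v≤n = begin
      Δ (λ v → f v - c * δ j v) v      ≡⟨ Δ-sub f (λ v → c * δ j v) v ⟩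
      Δ f v - Δ (λ v → c * δ j v) v    ≡⟨ cong₂ _-_ (Δf≡ v 1≤v v≤n) (Δ-* c (δ j) v) ⟩
      b v + c * Δ (δ j) v - c * Δ (δ j) v ≡⟨ cancel (b v) (c * Δ (δ j) v) ⟩
      b v                              ∎
      where
      open ≡-Reasoning
      cancel : ∀ x y → x + y - y ≡ x
      cancel = solve-∀

  -- Adding b(r+1) Δ δ_{r+2}, which is −1 at r + 1 and 0 further left, clears vertex r + 1.
  principal-sweep : ∀ t r → r ℕ.+ t ≡ p → ∀ b → (∀ v → 1 ℕ.≤ v → v ℕ.≤ r → b v ≡ 0ℤ) → M ∣ weight b → Principal b
  principal-sweep zero r r+0≡p b vanish M∣wb =
    principal-at-end b (λ v 1≤v v≤p → vanish v 1≤v (subst (v ℕ.≤_) (trans (sym r+0≡p) (ℕ.+-identityʳ r)) v≤p)) M∣wb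
  principal-sweep (suc t) r r+1+t≡p b vanish M∣wb =
    principal-shift b β j (principal-sweep t (suc r) (trans (sym (ℕ.+-suc r t)) r+1+t≡p) b′ vanish′ M∣wb′)
    where
    j = suc (suc r)
    β = b (suc r)
    h = Δ (δ j)
    b′ : ℕ → ℤ
    b′ v = b v + β * h v
    j≤n : j ℕ.≤ n
    j≤n = s≤s (subst (suc r ℕ.≤_) r+1+t≡p (ℕ.≤-trans (ℕ.m≤m+n (suc r) t) (ℕ.≤-reflexive (sym (ℕ.+-suc r t)))))
    h-left : ∀ v → v ℕ.≤ r → h v ≡ 0ℤ
    h-left v v≤r = Δ-local (δ j) v (δ-off (ℕ.<⇒≢ (s≤s (ℕ.m≤n⇒m≤1+n (ℕ.≤-trans ℕ.pred[n]≤n v≤r)))))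
                                   (δ-off (ℕ.<⇒≢ (s≤s (ℕ.m≤n⇒m≤1+n v≤r))))
                                   (δ-off (ℕ.<⇒≢ (s≤s (s≤s v≤r))))
    h-next : h (suc r) ≡ - 1ℤ
    h-next rewrite Δ-𝟙 (δ j) (suc r) | δ-off {suc r} {j} (ℕ.<⇒≢ ℕ.≤-refl) | δ-off {r} {j} (ℕ.<⇒≢ (ℕ.n≤1+n _))
                 | δ-diag j | dec-true (suc r ℕ.<? n) j≤n = identity (𝟙 (does (1 ℕ.<? suc r)))
      where
      identity : ∀ s → 0ℤ + s * (0ℤ - 0ℤ) + 1ℤ * (0ℤ - 1ℤ) ≡ - 1ℤ
      identity = solve-∀
    vanish′ : ∀ v → 1 ℕ.≤ v → v ℕ.≤ suc r → b′ v ≡ 0ℤ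
    vanish′ v 1≤v v≤r+1 with ℕ.m≤n⇒m<n∨m≡n v≤r+1
    ... | inj₁ v≤r = trans (cong₂ (λ x y → x + β * y) (vanish v 1≤v (ℕ.≤-pred v≤r)) (h-left v (ℕ.≤-pred v≤r)))
                           (trans (+-identityˡ _) (*-zeroʳ β))
    ... | inj₂ refl = trans (cong (λ y → β + β * y) h-next) (cancel β)
      where
      cancel : ∀ x → x + x * (- 1ℤ) ≡ 0ℤ
      cancel = solve-∀
    M∣wb′ : M ∣ weight b′
    M∣wb′ = subst (M ∣_) (sym (trans (weight-+ b (λ v → β * h v)) (cong (λ s → weight b + s) (weight-* β h))))
              (∣m∣n⇒∣m+n M∣wb (∣n⇒∣m*n β (subst (M ∣_) (sym (weight-Δ (δ j))) (∣n⇒∣m*n (δ j n) (∣-refl {M})))))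

  divisible⇒principal : ∀ b → M ∣ weight b → Principal b
  divisible⇒principal b = principal-sweep p 0 refl b (λ v 1≤v v≤0 → ⊥-elim (ℕ.<⇒≱ 1≤v v≤0))

  Effective : (ℕ → ℤ) → Set
  Effective E = ∀ v → 1 ℕ.≤ v → v ℕ.≤ n → 0ℤ ≤ E v

  when-mono : ∀ {P : Set} (d : Dec P) {x y} → (P → x ≤ y) → when (does d) x ≤ when (does d) y
  when-mono (yes p) x≤y = x≤y p
  when-mono (no _) _ = ≤-refl

  Δ-mono-at : ∀ f g v → 1 ℕ.≤ v → v ℕ.≤ n → g v ≤ f v →
    (∀ u → 1 ℕ.≤ u → u ℕ.≤ n → g v - g u ≤ f v - f u) → Δ g v ≤ Δ f v
  Δ-mono-at f g v 1≤v v≤n gv≤fv edge =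
    +-mono-≤ (+-mono-≤ gv≤fv (when-mono (1 ℕ.<? v) (λ 1<v → edge (pred v) (ℕ.<⇒≤pred 1<v) (ℕ.≤-trans ℕ.pred[n]≤n v≤n))))
             (when-mono (v ℕ.<? n) (λ v<n → edge (suc v) (s≤s z≤n) v<n))

  Δ-at : ∀ g v {c} → g v ≡ c →
    Δ g v ≡ c + when (does (1 ℕ.<? v)) (c - g (pred v)) + when (does (v ℕ.<? n)) (c - g (suc v))
  Δ-at g v refl = refl

  when-nonneg : ∀ {P : Set} (d : Dec P) {x} → (P → 0ℤ ≤ x) → 0ℤ ≤ when (does d) x
  when-nonneg (yes p) x≥0 = x≥0 p
  when-nonneg (no _) _ = ≤-refl

  private
    at-zero : ∀ {P Q : Set} (d₁ : Dec P) (d₂ : Dec Q) x y → (Q → 0ℤ ≤ y) →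
      0ℤ + when (does d₁) (0ℤ - x) + when (does d₂) (0ℤ - y) + when (does d₁) x ≤ 0ℤ
    at-zero (yes _) (yes q) x y y≥0 = subst (_≤ 0ℤ) (sym (identity x y)) (neg-mono-≤ (y≥0 q))
      where
      identity : ∀ x y → 0ℤ + (0ℤ - x) + (0ℤ - y) + x ≡ - y
      identity = solve-∀
    at-zero (yes _) (no _) x y _ = ≤-reflexive (identity x)
      where
      identity : ∀ x → 0ℤ + (0ℤ - x) + 0ℤ + x ≡ 0ℤ
      identity = solve-∀
    at-zero (no _) (yes q) x y y≥0 = subst (_≤ 0ℤ) (sym (identity y)) (neg-mono-≤ (y≥0 q))
      where
      identity : ∀ y → 0ℤ + 0ℤ + (0ℤ - y) + 0ℤ ≡ - y
      identity = solve-∀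
    at-zero (no _) (no _) x y _ = ≤-refl

    when-1- : ∀ b {x} → x ≤ 1ℤ → 0ℤ ≤ when b (1ℤ - x)
    when-1- true x≤1 = i≤j⇒0≤j-i x≤1
    when-1- false _ = ≤-refl

    when-0- : ∀ b {x} → 0ℤ ≤ x → - x ≤ when b (0ℤ - x)
    when-0- true _ = ≤-reflexive (sym (+-identityˡ _))
    when-0- false x≥0 = neg-mono-≤ x≥0

  Δ-at-zero-≤ : ∀ g v → Effective g → g v ≡ 0ℤ → Δ g v + when (does (1 ℕ.<? v)) (g (pred v)) ≤ 0ℤ
  Δ-at-zero-≤ g v g≥0 gv≡0 = begin
    Δ g v + when (does (1 ℕ.<? v)) (g (pred v))
      ≡⟨ cong (_+ when (does (1 ℕ.<? v)) (g (pred v))) (Δ-at g v gv≡0) ⟩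
    0ℤ + when (does (1 ℕ.<? v)) (0ℤ - g (pred v)) + when (does (v ℕ.<? n)) (0ℤ - g (suc v))
       + when (does (1 ℕ.<? v)) (g (pred v))
      ≤⟨ at-zero (1 ℕ.<? v) (v ℕ.<? n) (g (pred v)) (g (suc v)) (λ v<n → g≥0 (suc v) (s≤s z≤n) v<n) ⟩
    0ℤ ∎
    where open ≤-Reasoning

  Δ-at-zero-≥ : ∀ g v → g v ≡ 0ℤ → 0ℤ ≤ g (pred v) → 0ℤ ≤ g (suc v) → - (g (pred v) + g (suc v)) ≤ Δ g v
  Δ-at-zero-≥ g v gv≡0 g₀≥0 g₂≥0 = begin
    - (g (pred v) + g (suc v))        ≡⟨ neg-distrib-+ (g (pred v)) (g (suc v)) ⟩
    - g (pred v) + - g (suc v)        ≡⟨ cong (_+ - g (suc v)) (+-identityˡ (- g (pred v))) ⟨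
    0ℤ + - g (pred v) + - g (suc v)   ≤⟨ +-mono-≤ (+-monoʳ-≤ 0ℤ (when-0- (does (1 ℕ.<? v)) g₀≥0)) (when-0- (does (v ℕ.<? n)) g₂≥0) ⟩
    0ℤ + when (does (1 ℕ.<? v)) (0ℤ - g (pred v)) + when (does (v ℕ.<? n)) (0ℤ - g (suc v))
                                      ≡⟨ Δ-at g v gv≡0 ⟨
    Δ g v                             ∎
    where open ≤-Reasoning

  Δ-at-one-≥ : ∀ g v → g v ≡ 1ℤ → g (pred v) ≤ 1ℤ → g (suc v) ≤ 1ℤ → 1ℤ ≤ Δ g v
  Δ-at-one-≥ g v gv≡1 g₀≤1 g₂≤1 = begin
    1ℤ                    ≡⟨ +-identityʳ 1ℤ ⟨
    1ℤ + 0ℤ               ≡⟨ +-identityʳ (1ℤ + 0ℤ) ⟨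
    1ℤ + 0ℤ + 0ℤ          ≤⟨ +-mono-≤ (+-monoʳ-≤ 1ℤ (when-1- (does (1 ℕ.<? v)) g₀≤1)) (when-1- (does (v ℕ.<? n)) g₂≤1) ⟩
    1ℤ + when (does (1 ℕ.<? v)) (1ℤ - g (pred v)) + when (does (v ℕ.<? n)) (1ℤ - g (suc v))
                          ≡⟨ Δ-at g v gv≡1 ⟨
    Δ g v                 ∎
    where open ≤-Reasoning

  deg-fire : ∀ E h → deg (λ v → E v - Δ h v) ≡ deg E - deg h
  deg-fire E h = trans (∑-- n E (Δ h)) (cong (λ s → deg E - s) (deg-Δ h))

  fire-same-class : ∀ E h → M ∣ weight E - weight (λ v → E v - Δ h v)
  fire-same-class E h = subst (M ∣_) (sym (begin
    weight E - weight (λ v → E v - Δ h v)   ≡⟨ cong (λ s → weight E - s) (weight-- E (Δ h)) ⟩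
    weight E - (weight E - weight (Δ h))    ≡⟨ cancel (weight E) (weight (Δ h)) ⟩
    weight (Δ h)                            ≡⟨ weight-Δ h ⟩
    h n * M                                 ∎)) (∣n⇒∣m*n (h n) (∣-refl {M}))
    where
    open ≡-Reasoning
    cancel : ∀ x y → x - (x - y) ≡ y
    cancel = solve-∀

  deg-unfire : ∀ E g → deg (λ v → E v + Δ g v) ≡ deg E + deg g
  deg-unfire E g = trans (∑-+ n E (Δ g)) (cong (λ s → deg E + s) (deg-Δ g))

  unfire-same-class : ∀ E g → M ∣ weight E - weight (λ v → E v + Δ g v)
  unfire-same-class E g = subst (M ∣_) (sym (begin
    weight E - weight (λ v → E v + Δ g v)   ≡⟨ cong (λ w → weight E - w) (weight-+ E (Δ g)) ⟩
    weight E - (weight E + weight (Δ g))    ≡⟨ cancel (weight E) (weight (Δ g)) ⟩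
    - weight (Δ g)                          ≡⟨ cong -_ (weight-Δ g) ⟩
    - (g n * M)                             ∎)) (∣m⇒∣-m (∣n⇒∣m*n (g n) (∣-refl {M})))
    where
    open ≡-Reasoning
    cancel : ∀ u w → u - (u + w) ≡ - w
    cancel = solve-∀

  argmax : (ℕ → ℤ) → ℕ → ℤ
  argmax f u = 𝟙 (does (f u ≟ maximum n f))

  argmax-cases : ∀ f u → 1 ℕ.≤ u → u ℕ.≤ n →
    (f u ≡ maximum n f × argmax f u ≡ 1ℤ) ⊎ (f u < maximum n f × argmax f u ≡ 0ℤ)
  argmax-cases f u 1≤u u≤n with f u ≟ maximum n f
  ... | yes fu≡μ = inj₁ (fu≡μ , refl)
  ... | no fu≢μ = inj₂ (≤∧≢⇒< (maximum-upper n f u 1≤u u≤n) fu≢μ , refl)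

  deg-argmax : ∀ f → 0ℤ < deg (argmax f)
  deg-argmax f with maximum-attained p f
  ... | v₀ , 1≤v₀ , v₀≤n , fv₀≡μ with argmax-cases f v₀ 1≤v₀ v₀≤n
  ...   | inj₁ (_ , h≡1) = suc[i]≤j⇒i<j (subst (_≤ deg (argmax f)) h≡1 (∑-term n (λ u _ _ → 𝟙-nonneg _) v₀ 1≤v₀ v₀≤n))
  ...   | inj₂ (fv₀<μ , _) = ⊥-elim (<-irrefl fv₀≡μ fv₀<μ)

  -- Firing only the vertices where f is maximal sends out no more chips from any of them than f does.
  fire-argmax-effective : ∀ (E f : ℕ → ℤ) → Effective E → Effective (λ v → E v - Δ f v) → 0ℤ < maximum n f →
    Effective (λ v → E v - Δ (argmax f) v)
  fire-argmax-effective E f E≥0 E-Δf≥0 μ>0 v 1≤v v≤n with argmax-cases f v 1≤v v≤n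
  ... | inj₁ (fv≡μ , hv≡1) = ≤-trans (E-Δf≥0 v 1≤v v≤n) (+-monoʳ-≤ (E v) (neg-mono-≤ Δh≤Δf))
    where
    μ = maximum n f
    h = argmax f
    1-h≤μ-f : ∀ u → 1 ℕ.≤ u → u ℕ.≤ n → 1ℤ - h u ≤ μ - f u
    1-h≤μ-f u 1≤u u≤n with argmax-cases f u 1≤u u≤n
    ... | inj₁ (fu≡μ , hu≡1) rewrite fu≡μ | hu≡1 = ≤-reflexive (trans (+-inverseʳ 1ℤ) (sym (+-inverseʳ μ)))
    ... | inj₂ (fu<μ , hu≡0) rewrite hu≡0 = begin
      1ℤ - 0ℤ           ≡⟨ +-identityʳ 1ℤ ⟩
      1ℤ                ≤⟨ 0≤i-j⇒j≤i (subst (0ℤ ≤_) (shift μ (f u)) (i≤j⇒0≤j-i (i<j⇒suc[i]≤j fu<μ))) ⟩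
      μ - f u           ∎
      where
      open ≤-Reasoning
      shift : ∀ m x → m - (1ℤ + x) ≡ m - x - 1ℤ
      shift = solve-∀
    Δh≤Δf : Δ h v ≤ Δ f v
    Δh≤Δf = Δ-mono-at f h v 1≤v v≤n
      (subst₂ _≤_ (sym hv≡1) (sym fv≡μ) (i<j⇒suc[i]≤j μ>0))
      (λ u 1≤u u≤n → subst₂ (λ x y → x - h u ≤ y - f u) (sym hv≡1) (sym fv≡μ) (1-h≤μ-f u 1≤u u≤n))
  ... | inj₂ (_ , hv≡0) = ≤-trans (E≥0 v 1≤v v≤n) (begin
    E v                        ≡⟨ +-identityʳ (E v) ⟨
    E v - 0ℤ                   ≤⟨ +-monoʳ-≤ (E v) (neg-mono-≤ Δh≤0) ⟩
    E v - Δ (argmax f) v       ∎)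
    where
    open ≤-Reasoning
    Δh≤0 : Δ (argmax f) v ≤ 0ℤ
    Δh≤0 = ≤-trans (Δ-mono-at (λ _ → 0ℤ) (argmax f) v 1≤v v≤n (≤-reflexive hv≡0)
                     (λ u _ _ → subst (λ x → x - argmax f u ≤ 0ℤ) (sym hv≡0)
                                  (≤-trans (≤-reflexive (+-identityˡ (- argmax f u))) (neg-mono-≤ (𝟙-nonneg _)))))
                   (≤-reflexive (Δ-const 0ℤ v))

  fire-maximal : ∀ (E f : ℕ → ℤ) → Effective E → Effective (λ v → E v - Δ f v) → 0ℤ < maximum n f →
    Σ[ F ∈ (ℕ → ℤ) ] (Effective F × deg F < deg E × M ∣ weight E - weight F)
  fire-maximal E f E≥0 E-Δf≥0 μ>0 =
    (λ v → E v - Δ (argmax f) v) , fire-argmax-effective E f E≥0 E-Δf≥0 μ>0 , degree , fire-same-class E (argmax f)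
    where
    degree : deg (λ v → E v - Δ (argmax f) v) < deg E
    degree = begin-strict
      deg (λ v → E v - Δ (argmax f) v)  ≡⟨ deg-fire E (argmax f) ⟩
      deg E - deg (argmax f)            <⟨ +-monoʳ-< (deg E) (neg-mono-< (deg-argmax f)) ⟩
      deg E + 0ℤ                        ≡⟨ +-identityʳ (deg E) ⟩
      deg E                             ∎
      where open ≤-Reasoning

  Vanishes : (ℕ → ℤ) → ℕ → ℕ → Set
  Vanishes E i₀ ℓ = ∀ t → t ℕ.< ℓ → E (suc (i₀ ℕ.+ t)) ≡ 0ℤ

  zero-spreads-left : ∀ (E g : ℕ → ℤ) w → Effective g → Effective (λ v → E v + Δ g v) → suc (suc w) ℕ.≤ n →
    E (suc (suc w)) ≡ 0ℤ → g (suc (suc w)) ≡ 0ℤ → g (suc w) ≡ 0ℤ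
  zero-spreads-left E g w g≥0 E+Δg≥0 w+2≤n Ev≡0 gv≡0 = ≤-antisym gw≤0 (g≥0 (suc w) (s≤s z≤n) (ℕ.≤-trans (ℕ.n≤1+n _) w+2≤n))
    where
    v = suc (suc w)
    Δgv≥0 : 0ℤ ≤ Δ g v
    Δgv≥0 = subst (0ℤ ≤_) (trans (cong (_+ Δ g v) Ev≡0) (+-identityˡ _)) (E+Δg≥0 v (s≤s z≤n) w+2≤n)
    gw≤0 : g (suc w) ≤ 0ℤ
    gw≤0 = begin
      g (suc w)               ≡⟨ +-identityˡ _ ⟨
      0ℤ + g (suc w)          ≤⟨ +-monoˡ-≤ (g (suc w)) Δgv≥0 ⟩
      Δ g v + g (suc w)       ≤⟨ Δ-at-zero-≤ g v g≥0 gv≡0 ⟩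
      0ℤ                      ∎
      where open ≤-Reasoning

  no-gain-at-zero : ∀ (E g : ℕ → ℤ) v → v ℕ.≤ n → Effective g → E v ≡ 0ℤ → g v ≡ 0ℤ → E v + Δ g v ≤ 0ℤ
  no-gain-at-zero E g v v≤n g≥0 Ev≡0 gv≡0 = begin
    E v + Δ g v                                   ≡⟨ cong (_+ Δ g v) Ev≡0 ⟩
    0ℤ + Δ g v                                    ≡⟨ +-identityˡ _ ⟩
    Δ g v                                         ≡⟨ +-identityʳ _ ⟨
    Δ g v + 0ℤ                                    ≤⟨ +-monoʳ-≤ (Δ g v) (when-nonneg (1 ℕ.<? v) (λ 1<v →
                                                    g≥0 (pred v) (ℕ.<⇒≤pred 1<v) (ℕ.≤-trans ℕ.pred[n]≤n v≤n))) ⟩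
    Δ g v + when (does (1 ℕ.<? v)) (g (pred v))   ≤⟨ Δ-at-zero-≤ g v g≥0 gv≡0 ⟩
    0ℤ                                            ∎
    where open ≤-Reasoning

  run-vertex : ∀ {i₀ ℓ t} → i₀ ℕ.+ ℓ ℕ.≤ n → t ℕ.< ℓ → suc (i₀ ℕ.+ t) ℕ.≤ n
  run-vertex {i₀} {ℓ} {t} i₀+ℓ≤n t<ℓ = ℕ.≤-trans (subst (ℕ._≤ i₀ ℕ.+ ℓ) (ℕ.+-suc i₀ t) (ℕ.+-monoʳ-≤ i₀ t<ℓ)) i₀+ℓ≤n

  run-fired : ∀ (E g : ℕ → ℤ) → Effective g → Effective (λ v → E v + Δ g v) → ∀ i₀ ℓ → i₀ ℕ.+ ℓ ℕ.≤ n →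
    Vanishes E i₀ ℓ → 1ℤ ≤ E (suc i₀) + Δ g (suc i₀) → ∀ t → t ℕ.< ℓ → 1ℤ ≤ g (suc (i₀ ℕ.+ t))
  run-fired E g g≥0 E+Δg≥0 i₀ ℓ i₀+ℓ≤n E≡0 gained t t<ℓ with g (suc (i₀ ℕ.+ t)) ≟ 0ℤ
  ... | no g≢0 = i<j⇒suc[i]≤j (≤∧≢⇒< (g≥0 _ (s≤s z≤n) (run-vertex i₀+ℓ≤n t<ℓ)) (g≢0 ∘ sym))
  ... | yes g≡0 = ⊥-elim (<-irrefl refl (≤-<-trans (no-gain-at-zero E g (suc i₀) start≤n g≥0 E₀≡0 (spread t t<ℓ g≡0))
                                                   (suc[i]≤j⇒i<j gained)))
    where
    start≤n : suc i₀ ℕ.≤ n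
    start≤n = subst (ℕ._≤ n) (cong suc (ℕ.+-identityʳ i₀)) (run-vertex i₀+ℓ≤n (ℕ.≤-trans (s≤s z≤n) t<ℓ))
    E₀≡0 : E (suc i₀) ≡ 0ℤ
    E₀≡0 = subst (λ z → E (suc z) ≡ 0ℤ) (ℕ.+-identityʳ i₀) (E≡0 0 (ℕ.≤-trans (s≤s z≤n) t<ℓ))
    spread : ∀ t → t ℕ.< ℓ → g (suc (i₀ ℕ.+ t)) ≡ 0ℤ → g (suc i₀) ≡ 0ℤ
    spread zero _ g≡0 = subst (λ z → g (suc z) ≡ 0ℤ) (ℕ.+-identityʳ i₀) g≡0
    spread (suc t) t+1<ℓ g≡0 = spread t (ℕ.<-trans (ℕ.n<1+n t) t+1<ℓ)
      (zero-spreads-left E g (i₀ ℕ.+ t) g≥0 E+Δg≥0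
        (subst (λ z → suc z ℕ.≤ n) (ℕ.+-suc i₀ t) (run-vertex i₀+ℓ≤n t+1<ℓ))
        (subst (λ z → E (suc z) ≡ 0ℤ) (ℕ.+-suc i₀ t) (E≡0 (suc t) t+1<ℓ))
        (subst (λ z → g (suc z) ≡ 0ℤ) (ℕ.+-suc i₀ t) g≡0))

  run-cost : ∀ (E g : ℕ → ℤ) → Effective g → Effective (λ v → E v + Δ g v) → ∀ i₀ ℓ → i₀ ℕ.+ ℓ ℕ.≤ n →
    Vanishes E i₀ ℓ → 1ℤ ≤ E (suc i₀) + Δ g (suc i₀) → deg E + + ℓ ≤ deg (λ v → E v + Δ g v)
  run-cost E g g≥0 E+Δg≥0 i₀ ℓ i₀+ℓ≤n E≡0 gained = begin
    deg E + + ℓ                   ≤⟨ +-monoʳ-≤ (deg E) (≤-trans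
                                       (∑-run i₀ ℓ (λ v 1≤v v≤ → g≥0 v 1≤v (ℕ.≤-trans v≤ i₀+ℓ≤n))
                                                   (run-fired E g g≥0 E+Δg≥0 i₀ ℓ i₀+ℓ≤n E≡0 gained))
                                       (∑-extend i₀+ℓ≤n g≥0)) ⟩
    deg E + deg g                 ≡⟨ deg-unfire E g ⟨
    deg (λ v → E v + Δ g v)       ∎
    where open ≤-Reasoning

  cover-bound : ∀ {q z ℓ r} → q ℕ.≤ z ℕ.* suc ℓ ℕ.+ r → r ℕ.≤ ℓ → suc q ℕ.≤ suc z ℕ.* suc ℓ
  cover-bound {q} {z} {ℓ} {r} q≤ r≤ℓ = begin
    suc q                            ≤⟨ s≤s (ℕ.≤-trans q≤ (ℕ.+-monoʳ-≤ (z ℕ.* suc ℓ) r≤ℓ)) ⟩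
    suc (z ℕ.* suc ℓ ℕ.+ ℓ)          ≡⟨ ℕ.+-suc _ ℓ ⟨
    z ℕ.* suc ℓ ℕ.+ suc ℓ            ≡⟨ ℕ.+-comm _ (suc ℓ) ⟩
    suc z ℕ.* suc ℓ                  ∎
    where open ℕ.≤-Reasoning

  -- Reading vertices 1 .. q from the left: the longest chip-free run so far, the run still open at q, and the
  -- count of chip-carrying vertices, each of which ends a run of length at most `longest` (this is `covers`).
  record Scan (E : ℕ → ℤ) (q : ℕ) : Set where
    field
      nonzero : ℕ
      nonzero≤deg : + nonzero ≤ ∑ q E
      open-start open-length : ℕ
      open-ends : open-start ℕ.+ open-length ≡ q
      open-vanishes : Vanishes E open-start open-length
      longest-start longest : ℕ
      longest-fits : longest-start ℕ.+ longest ℕ.≤ q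
      longest-vanishes : Vanishes E longest-start longest
      open≤longest : open-length ℕ.≤ longest
      covers : q ℕ.≤ nonzero ℕ.* suc longest ℕ.+ open-length

  scan-zero : ∀ {E q} → Scan E q → E (suc q) ≡ 0ℤ → Scan E (suc q)
  scan-zero {E} {q} s Eq+1≡0 = keep-or-replace (suc open-length ℕ.≤? longest)
    where
    open Scan s
    open-ends′ : open-start ℕ.+ suc open-length ≡ suc q
    open-ends′ = trans (ℕ.+-suc open-start open-length) (cong suc open-ends)
    open-vanishes′ : Vanishes E open-start (suc open-length)
    open-vanishes′ t t<r+1 with ℕ.m≤n⇒m<n∨m≡n (ℕ.≤-pred t<r+1)
    ... | inj₁ t<r = open-vanishes t t<r
    ... | inj₂ refl = subst (λ x → E (suc x) ≡ 0ℤ) (sym open-ends) Eq+1≡0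
    nonzero≤deg′ : + nonzero ≤ ∑ (suc q) E
    nonzero≤deg′ = subst₂ _≤_ (+-identityʳ (+ nonzero)) (cong (λ e → ∑ q E + e) (sym Eq+1≡0)) (+-mono-≤ nonzero≤deg ≤-refl)
    covers′ : ∀ ℓ → longest ℕ.≤ ℓ → suc q ℕ.≤ nonzero ℕ.* suc ℓ ℕ.+ suc open-length
    covers′ ℓ longest≤ℓ = subst (suc q ℕ.≤_) (sym (ℕ.+-suc _ open-length))
      (s≤s (ℕ.≤-trans covers (ℕ.+-monoˡ-≤ open-length (ℕ.*-monoʳ-≤ nonzero (s≤s longest≤ℓ)))))
    keep-or-replace : Dec (suc open-length ℕ.≤ longest) → Scan E (suc q)
    keep-or-replace (yes r+1≤ℓ) = record
      { nonzero = nonzero ; nonzero≤deg = nonzero≤deg′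
      ; open-start = open-start ; open-length = suc open-length ; open-ends = open-ends′ ; open-vanishes = open-vanishes′
      ; longest-start = longest-start ; longest = longest ; longest-fits = ℕ.m≤n⇒m≤1+n longest-fits
      ; longest-vanishes = longest-vanishes ; open≤longest = r+1≤ℓ ; covers = covers′ longest ℕ.≤-refl }
    keep-or-replace (no r+1≰ℓ) = record
      { nonzero = nonzero ; nonzero≤deg = nonzero≤deg′
      ; open-start = open-start ; open-length = suc open-length ; open-ends = open-ends′ ; open-vanishes = open-vanishes′
      ; longest-start = open-start ; longest = suc open-length ; longest-fits = ℕ.≤-reflexive open-ends′
      ; longest-vanishes = open-vanishes′ ; open≤longest = ℕ.≤-refl
      ; covers = covers′ (suc open-length) (ℕ.<⇒≤ (ℕ.≰⇒> r+1≰ℓ)) }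

  scan-chip : ∀ {E q} → Scan E q → 1ℤ ≤ E (suc q) → Scan E (suc q)
  scan-chip {E} {q} s Eq+1≥1 = record
    { nonzero = suc nonzero ; nonzero≤deg = nonzero≤deg′
    ; open-start = suc q ; open-length = 0 ; open-ends = ℕ.+-identityʳ (suc q) ; open-vanishes = λ _ ()
    ; longest-start = longest-start ; longest = longest ; longest-fits = ℕ.m≤n⇒m≤1+n longest-fits
    ; longest-vanishes = longest-vanishes ; open≤longest = z≤n
    ; covers = subst (suc q ℕ.≤_) (sym (ℕ.+-identityʳ _)) (cover-bound {z = nonzero} covers open≤longest) }
    where
    open Scan s
    nonzero≤deg′ : + suc nonzero ≤ ∑ (suc q) E
    nonzero≤deg′ = subst (_≤ ∑ (suc q) E) (cong +_ (ℕ.+-comm nonzero 1)) (+-mono-≤ nonzero≤deg Eq+1≥1)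

  scan : ∀ (E : ℕ → ℤ) → Effective E → ∀ q → q ℕ.≤ n → Scan E q
  scan E E≥0 zero _ = record
    { nonzero = 0 ; nonzero≤deg = ≤-refl
    ; open-start = 0 ; open-length = 0 ; open-ends = refl ; open-vanishes = λ _ ()
    ; longest-start = 0 ; longest = 0 ; longest-fits = z≤n ; longest-vanishes = λ _ ()
    ; open≤longest = z≤n ; covers = z≤n }
  scan E E≥0 (suc q) q+1≤n with E (suc q) ≟ 0ℤ
  ... | yes Eq+1≡0 = scan-zero (scan E E≥0 q (ℕ.≤-trans (ℕ.n≤1+n q) q+1≤n)) Eq+1≡0
  ... | no Eq+1≢0 = scan-chip (scan E E≥0 q (ℕ.≤-trans (ℕ.n≤1+n q) q+1≤n))
                      (i<j⇒suc[i]≤j (≤∧≢⇒< (E≥0 (suc q) (s≤s z≤n) q+1≤n) (Eq+1≢0 ∘ sym)))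

  longest-zero-run : ∀ E m → Effective E → deg E ≡ + m →
    Σ[ i₀ ∈ ℕ ] Σ[ ℓ ∈ ℕ ] (i₀ ℕ.+ ℓ ℕ.≤ n × Vanishes E i₀ ℓ × suc n ℕ.≤ suc m ℕ.* suc ℓ)
  longest-zero-run E m E≥0 degE≡m = from-scan (scan E E≥0 n ℕ.≤-refl)
    where
    from-scan : Scan E n → Σ[ i₀ ∈ ℕ ] Σ[ ℓ ∈ ℕ ] (i₀ ℕ.+ ℓ ℕ.≤ n × Vanishes E i₀ ℓ × suc n ℕ.≤ suc m ℕ.* suc ℓ)
    from-scan s = longest-start , longest , longest-fits , longest-vanishes ,
      ℕ.≤-trans (cover-bound {z = nonzero} covers open≤longest) (ℕ.*-monoˡ-≤ (suc longest) (s≤s nonzero≤m))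
      where
      open Scan s
      nonzero≤m : nonzero ℕ.≤ m
      nonzero≤m = drop‿+≤+ (subst (+ nonzero ≤_) degE≡m nonzero≤deg)

  run-start≤n : ∀ i₀ ℓ → i₀ ℕ.+ suc ℓ ℕ.≤ n → suc i₀ ℕ.≤ n
  run-start≤n i₀ ℓ fits = ℕ.≤-trans (s≤s (ℕ.m≤m+n i₀ ℓ)) (subst (ℕ._≤ n) (ℕ.+-suc i₀ ℓ) fits)

  reduce-or-pay : ∀ E E′ → Effective E → Effective E′ → Principal (λ v → E v - E′ v) →
    ∀ i₀ ℓ → i₀ ℕ.+ suc ℓ ℕ.≤ n → Vanishes E i₀ (suc ℓ) → 1ℤ ≤ E′ (suc i₀) →
    (Σ[ F ∈ (ℕ → ℤ) ] (Effective F × deg F < deg E × M ∣ weight E - weight F)) ⊎ (deg E + + suc ℓ ≤ deg E′)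
  reduce-or-pay E E′ E≥0 E′≥0 (f , Δf≡) i₀ ℓ fits vanishes gained = decide (0ℤ <? maximum n f)
    where
    E′≡ : ∀ v → 1 ℕ.≤ v → v ℕ.≤ n → E′ v ≡ E v - Δ f v
    E′≡ v 1≤v v≤n = sym (trans (cong (λ s → E v - s) (Δf≡ v 1≤v v≤n)) (cancel (E v) (E′ v)))
      where
      cancel : ∀ u w → u - (u - w) ≡ w
      cancel = solve-∀
    decide : Dec (0ℤ < maximum n f) →
      (Σ[ F ∈ (ℕ → ℤ) ] (Effective F × deg F < deg E × M ∣ weight E - weight F)) ⊎ (deg E + + suc ℓ ≤ deg E′)
    decide (yes μ>0) = inj₁ (fire-maximal E f E≥0 (λ v 1≤v v≤n → subst (0ℤ ≤_) (E′≡ v 1≤v v≤n) (E′≥0 v 1≤v v≤n)) μ>0)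
    decide (no μ≯0) = inj₂ (subst (deg E + + suc ℓ ≤_) (sym (∑-cong n {E′} {λ v → E v + Δ g v} E′≡E+Δg))
      (run-cost E g g≥0 (λ v 1≤v v≤n → subst (0ℤ ≤_) (E′≡E+Δg v 1≤v v≤n) (E′≥0 v 1≤v v≤n)) i₀ (suc ℓ) fits vanishes
        (subst (1ℤ ≤_) (E′≡E+Δg (suc i₀) (s≤s z≤n) (run-start≤n i₀ ℓ fits)) gained)))
      where
      g : ℕ → ℤ
      g v = - f v
      g≥0 : Effective g
      g≥0 v 1≤v v≤n = neg-mono-≤ (≤-trans (maximum-upper n f v 1≤v v≤n) (≮⇒≥ μ≯0))
      E′≡E+Δg : ∀ v → 1 ℕ.≤ v → v ℕ.≤ n → E′ v ≡ E v + Δ g v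
      E′≡E+Δg v 1≤v v≤n = trans (E′≡ v 1≤v v≤n) (cong (λ s → E v + s) (sym (Δ-neg f v)))

  Represents : ℕ → (ℕ → ℤ) → Set
  Represents x E = M ∣ + x - weight E

  represents-difference : ∀ {x} E E′ → Represents x E → Represents x E′ → M ∣ weight (λ v → E v - E′ v)
  represents-difference {x} E E′ x~E x~E′ =
    subst (M ∣_) (trans (difference (+ x) (weight E) (weight E′)) (sym (weight-- E E′))) (∣m∣n⇒∣m-n x~E′ x~E)
    where
    difference : ∀ y u w → (y - w) - (y - u) ≡ u - w
    difference = solve-∀

  module Descent (x d : ℕ)
    (chip-at : ∀ k → 1 ℕ.≤ k → k ℕ.≤ n →
               Σ[ E′ ∈ (ℕ → ℤ) ] (Effective E′ × 1ℤ ≤ E′ k × deg E′ ≤ + d × Represents x E′)) where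

    Cheaper : (ℕ → ℤ) → Set
    Cheaper E = Σ[ F ∈ (ℕ → ℤ) ] (Effective F × deg F < deg E × Represents x F)

    run-step : ∀ E → Effective E → Represents x E → ∀ i₀ ℓ → i₀ ℕ.+ suc ℓ ℕ.≤ n → Vanishes E i₀ (suc ℓ) →
      Σ[ E′ ∈ (ℕ → ℤ) ] (Effective E′ × 1ℤ ≤ E′ (suc i₀) × deg E′ ≤ + d × Represents x E′) →
      Cheaper E ⊎ (deg E + + suc ℓ ≤ + d)
    run-step E E≥0 x~E i₀ ℓ fits vanishes (E′ , E′≥0 , gained , degE′≤d , x~E′) =
      Sum.map same-class (λ cost → ≤-trans cost degE′≤d)
        (reduce-or-pay E E′ E≥0 E′≥0 (divisible⇒principal (λ v → E v - E′ v) (represents-difference E E′ x~E x~E′))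
                       i₀ ℓ fits vanishes gained)
      where
      same-class : Σ[ F ∈ (ℕ → ℤ) ] (Effective F × deg F < deg E × M ∣ weight E - weight F) → Cheaper E
      same-class (F , F≥0 , degF<degE , M∣wE-wF) =
        F , F≥0 , degF<degE , subst (M ∣_) (telescope (+ x) (weight E) (weight F)) (∣m∣n⇒∣m+n x~E M∣wE-wF)
        where
        telescope : ∀ y u w → (y - u) + (u - w) ≡ y - w
        telescope = solve-∀

    descent : ∀ m → Acc ℕ._<_ m → ∀ E → Effective E → deg E ≡ + m → m ℕ.< d → Represents x E → Affordable n d
    descent m (acc smaller) E E≥0 degE≡m m<d x~E with longest-zero-run E m E≥0 degE≡m
    ... | _ , zero , _ , _ , bound = m , 0 , subst (ℕ._≤ d) (sym (ℕ.+-identityʳ m)) (ℕ.<⇒≤ m<d) , bound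
    ... | i₀ , suc ℓ , fits , vanishes , bound =
      Sum.[ recurse , pay ] (run-step E E≥0 x~E i₀ ℓ fits vanishes (chip-at (suc i₀) (s≤s z≤n) (run-start≤n i₀ ℓ fits)))
      where
      pay : deg E + + suc ℓ ≤ + d → Affordable n d
      pay cost = m , suc ℓ , drop‿+≤+ (subst (_≤ + d) (trans (cong (_+ + suc ℓ) degE≡m) (sym (pos-+ m (suc ℓ)))) cost) , bound
      recurse : Cheaper E → Affordable n d
      recurse (F , F≥0 , degF<degE , x~F) = descent m′ (smaller m′<m) F F≥0 (sym +m′≡degF) m′<d x~F
        where
        m′ = ∣ deg F ∣
        +m′≡degF : + m′ ≡ deg F
        +m′≡degF = 0≤i⇒+∣i∣≡i (∑-nonneg n F≥0)
        m′<m : m′ ℕ.< m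
        m′<m = drop‿+<+ (subst₂ _<_ (sym +m′≡degF) degE≡m degF<degE)
        m′<d : m′ ℕ.< d
        m′<d = ℕ.<-trans m′<m m<d

  InPath : ℕ → Set
  InPath k = 1 ℕ.≤ k × k ℕ.≤ n

  divisor : List ℕ → ℕ → ℤ
  divisor [] _ = 0ℤ
  divisor (k ∷ ks) v = δ k v + divisor ks v

  divisor-nonneg : ∀ ks v → 0ℤ ≤ divisor ks v
  divisor-nonneg [] v = ≤-refl
  divisor-nonneg (k ∷ ks) v = +-mono-≤ (δ-nonneg k v) (divisor-nonneg ks v)

  deg-divisor : ∀ ks → All InPath ks → deg (divisor ks) ≡ + length ks
  deg-divisor [] _ = ∑-zero n
  deg-divisor (k ∷ ks) ((1≤k , k≤n) ∷ ks∈) = begin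
    deg (λ v → δ k v + divisor ks v)         ≡⟨ ∑-+ n (δ k) (divisor ks) ⟩
    deg (δ k) + deg (divisor ks)             ≡⟨ cong₂ _+_ (trans (∑-cong n (λ v _ _ → sym (*-identityˡ (δ k v))))
                                                                 (∑-δ (λ _ → 1ℤ) k n 1≤k k≤n))
                                                          (deg-divisor ks ks∈) ⟩
    1ℤ + + length ks                         ≡⟨ pos-+ 1 (length ks) ⟨
    + length (k ∷ ks)                        ∎
    where open ≡-Reasoning

  weight-divisor : ∀ ks → All InPath ks → weight (divisor ks) ≡ + oddFibSum ks
  weight-divisor [] _ = trans (∑-cong n (λ v _ _ → *-zeroʳ (a v))) (∑-zero n)
  weight-divisor (k ∷ ks) ((1≤k , k≤n) ∷ ks∈) = begin
    weight (λ v → δ k v + divisor ks v)      ≡⟨ weight-+ (δ k) (divisor ks) ⟩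
    weight (δ k) + weight (divisor ks)       ≡⟨ cong₂ _+_ (∑-δ a k n 1≤k k≤n) (weight-divisor ks ks∈) ⟩
    a k + + oddFibSum ks                     ≡⟨ pos-+ (oddFib k) (oddFibSum ks) ⟨
    + oddFibSum (k ∷ ks)                     ∎
    where open ≡-Reasoning

  divisor-∈ : ∀ {k} ks → k ∈ ks → 1ℤ ≤ divisor ks k
  divisor-∈ {k} (_ ∷ ks) (here refl) = begin
    1ℤ                      ≡⟨ +-identityʳ 1ℤ ⟨
    1ℤ + 0ℤ                 ≤⟨ +-monoʳ-≤ 1ℤ (divisor-nonneg ks k) ⟩
    1ℤ + divisor ks k       ≡⟨ cong (_+ divisor ks k) (δ-diag k) ⟨
    δ k k + divisor ks k    ∎
    where open ≤-Reasoning
  divisor-∈ {k} (j ∷ ks) (there k∈ks) = begin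
    1ℤ                      ≡⟨ +-identityˡ 1ℤ ⟨
    0ℤ + 1ℤ                 ≤⟨ +-mono-≤ (δ-nonneg j k) (divisor-∈ ks k∈ks) ⟩
    δ j k + divisor ks k    ∎
    where open ≤-Reasoning

  represents-divisor : ∀ {x} ks → All InPath ks → x ≡ oddFibSum ks [mod fib (2 ℕ.* n) ] → Represents x (divisor ks)
  represents-divisor {x} ks ks∈ x≡ = subst (λ w → M ∣ + x - w) (sym (weight-divisor ks ks∈)) (∣ᵤ⇒∣ x≡)

  CoveringClass : ℕ → Set
  CoveringClass d = ∃ λ (x : ℕ) →
      (Σ (List ℕ) λ ks → All (λ k → 1 ℕ.≤ k × k ℕ.≤ n) ks × length ks ℕ.≤ d ℕ.∸ 1
         × x ≡ oddFibSum ks [mod fib (2 ℕ.* n) ])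
    × ((k : ℕ) → 1 ℕ.≤ k → k ℕ.≤ n →
        Σ (List ℕ) λ ks → All (λ j → 1 ℕ.≤ j × j ℕ.≤ n) ks × length ks ℕ.≤ d × k ∈ ks
         × x ≡ oddFibSum ks [mod fib (2 ℕ.* n) ])

  covering⇒affordable : ∀ d → 1 ℕ.≤ d → CoveringClass d → Affordable n d
  covering⇒affordable d 1≤d (x , (ks₀ , ks₀∈ , len≤d-1 , x≡ks₀) , covers) =
    descent (length ks₀) (<-wellFounded _) (divisor ks₀) (λ v _ _ → divisor-nonneg ks₀ v) (deg-divisor ks₀ ks₀∈)
      (ℕ.≤-trans (s≤s len≤d-1) (ℕ.≤-reflexive (ℕ.m+[n∸m]≡n 1≤d))) (represents-divisor ks₀ ks₀∈ x≡ks₀)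
    where
    chip-at : ∀ k → 1 ℕ.≤ k → k ℕ.≤ n →
      Σ[ E′ ∈ (ℕ → ℤ) ] (Effective E′ × 1ℤ ≤ E′ k × deg E′ ≤ + d × Represents x E′)
    chip-at k 1≤k k≤n with covers k 1≤k k≤n
    ... | ks , ks∈ , len≤d , k∈ks , x≡ks =
      divisor ks , (λ v _ _ → divisor-nonneg ks v) , divisor-∈ ks k∈ks ,
      subst (_≤ + d) (sym (deg-divisor ks ks∈)) (+≤+ len≤d) , represents-divisor ks ks∈ x≡ks
    open Descent x d chip-at

  chips : (ℕ → ℤ) → ℕ → List ℕ
  chips E zero = []
  chips E (suc m) = replicate ∣ E (suc m) ∣ (suc m) ++ chips E m

  chips-InPath : ∀ E m → m ℕ.≤ n → All InPath (chips E m)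
  chips-InPath E zero _ = []
  chips-InPath E (suc m) m+1≤n = ++⁺ (replicate⁺ _ (s≤s z≤n , m+1≤n)) (chips-InPath E m (ℕ.≤-trans (ℕ.n≤1+n m) m+1≤n))

  ∈-chips : ∀ E m k → 1 ℕ.≤ k → k ℕ.≤ m → 1ℤ ≤ E k → k ∈ chips E m
  ∈-chips E zero k 1≤k k≤0 _ = ⊥-elim (ℕ.<⇒≱ 1≤k k≤0)
  ∈-chips E (suc m) k 1≤k k≤m+1 Ek≥1 with ℕ.m≤n⇒m<n∨m≡n k≤m+1
  ... | inj₁ k<m+1 = ∈-++⁺ʳ (replicate ∣ E (suc m) ∣ (suc m)) (∈-chips E m k 1≤k (ℕ.≤-pred k<m+1) Ek≥1)
  ... | inj₂ refl = ∈-++⁺ˡ (∈-replicate ∣ E k ∣ (drop‿+≤+ (subst (1ℤ ≤_) (sym (0≤i⇒+∣i∣≡i (≤-trans (+≤+ z≤n) Ek≥1))) Ek≥1)))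
    where
    ∈-replicate : ∀ c → 1 ℕ.≤ c → k ∈ replicate c k
    ∈-replicate (suc c) _ = here refl

  length-chips : ∀ E m → (∀ v → 1 ℕ.≤ v → v ℕ.≤ m → 0ℤ ≤ E v) → + length (chips E m) ≡ ∑ m E
  length-chips E zero _ = refl
  length-chips E (suc m) E≥0 = begin
    + length (replicate c (suc m) ++ chips E m)      ≡⟨ cong +_ (length-++ (replicate c (suc m))) ⟩
    + (length (replicate c (suc m)) ℕ.+ length (chips E m))
                                                     ≡⟨ cong (λ l → + (l ℕ.+ length (chips E m))) (length-replicate c) ⟩
    + (c ℕ.+ length (chips E m))                     ≡⟨ cong +_ (ℕ.+-comm c _) ⟩
    + (length (chips E m) ℕ.+ c)                     ≡⟨ pos-+ (length (chips E m)) c ⟩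
    + length (chips E m) + + c                       ≡⟨ cong₂ _+_ (length-chips E m (λ v 1≤v v≤m → E≥0 v 1≤v (ℕ.m≤n⇒m≤1+n v≤m)))
                                                                 (0≤i⇒+∣i∣≡i (E≥0 (suc m) (s≤s z≤n) ℕ.≤-refl)) ⟩
    ∑ m E + E (suc m)                                ∎
    where
    open ≡-Reasoning
    c = ∣ E (suc m) ∣

  oddFibSum-replicate : ∀ c v → oddFibSum (replicate c v) ≡ c ℕ.* oddFib v
  oddFibSum-replicate zero v = refl
  oddFibSum-replicate (suc c) v = cong (oddFib v ℕ.+_) (oddFibSum-replicate c v)

  oddFibSum-++ : ∀ ks js → oddFibSum (ks ++ js) ≡ oddFibSum ks ℕ.+ oddFibSum js
  oddFibSum-++ ks js = trans (cong sum (map-++ oddFib ks js)) (sum-++ (map oddFib ks) (map oddFib js))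

  oddFibSum-chips : ∀ E m → (∀ v → 1 ℕ.≤ v → v ℕ.≤ m → 0ℤ ≤ E v) → + oddFibSum (chips E m) ≡ ∑ m (λ v → a v * E v)
  oddFibSum-chips E zero _ = refl
  oddFibSum-chips E (suc m) E≥0 = begin
    + oddFibSum (replicate c (suc m) ++ chips E m)          ≡⟨ cong +_ (oddFibSum-++ (replicate c (suc m)) (chips E m)) ⟩
    + (oddFibSum (replicate c (suc m)) ℕ.+ oddFibSum (chips E m))
                                                            ≡⟨ cong (λ s → + (s ℕ.+ oddFibSum (chips E m))) (oddFibSum-replicate c (suc m)) ⟩
    + (c ℕ.* oddFib (suc m) ℕ.+ oddFibSum (chips E m))      ≡⟨ cong +_ (ℕ.+-comm _ (oddFibSum (chips E m))) ⟩
    + (oddFibSum (chips E m) ℕ.+ c ℕ.* oddFib (suc m))      ≡⟨ pos-+ (oddFibSum (chips E m)) _ ⟩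
    + oddFibSum (chips E m) + + (c ℕ.* oddFib (suc m))      ≡⟨ cong₂ _+_ (oddFibSum-chips E m (λ v 1≤v v≤m → E≥0 v 1≤v (ℕ.m≤n⇒m≤1+n v≤m)))
                                                                        (trans (pos-* c (oddFib (suc m))) (*-comm (+ c) (a (suc m)))) ⟩
    ∑ m (λ v → a v * E v) + a (suc m) * + c                 ≡⟨ cong (λ e → ∑ m (λ v → a v * E v) + a (suc m) * e)
                                                                    (0≤i⇒+∣i∣≡i (E≥0 (suc m) (s≤s z≤n) ℕ.≤-refl)) ⟩
    ∑ m (λ v → a v * E v) + a (suc m) * E (suc m)           ∎
    where
    open ≡-Reasoning
    c = ∣ E (suc m) ∣

  chips-represent : ∀ E₀ E → Effective E₀ → Effective E → M ∣ weight E₀ - weight E →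
    oddFibSum (chips E₀ n) ≡ oddFibSum (chips E n) [mod fib (2 ℕ.* n) ]
  chips-represent E₀ E E₀≥0 E≥0 M∣ =
    ∣⇒∣ᵤ (subst₂ (λ u w → M ∣ u - w) (sym (oddFibSum-chips E₀ n E₀≥0)) (sym (oddFibSum-chips E n E≥0)) M∣)

  divisors⇒covering : ∀ d E₀ → Effective E₀ → deg E₀ ≤ + (d ℕ.∸ 1) →
    (∀ k → 1 ℕ.≤ k → k ℕ.≤ n → Σ[ E ∈ (ℕ → ℤ) ] (Effective E × 1ℤ ≤ E k × deg E ≤ + d × M ∣ weight E₀ - weight E)) →
    CoveringClass d
  divisors⇒covering d E₀ E₀≥0 degE₀≤ chip-at =
    oddFibSum (chips E₀ n) ,
    (chips E₀ n , chips-InPath E₀ n ℕ.≤-refl , length≤ E₀ E₀≥0 degE₀≤ ,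
     chips-represent E₀ E₀ E₀≥0 E₀≥0 (subst (M ∣_) (sym (+-inverseʳ (weight E₀))) (divides 0ℤ refl))) ,
    covers
    where
    length≤ : ∀ E {b} → Effective E → deg E ≤ + b → length (chips E n) ℕ.≤ b
    length≤ E E≥0 degE≤b = drop‿+≤+ (subst (_≤ + _) (sym (length-chips E n E≥0)) degE≤b)
    covers : ∀ k → 1 ℕ.≤ k → k ℕ.≤ n → Σ (List ℕ) λ ks → All InPath ks × length ks ℕ.≤ d × k ∈ ks
               × oddFibSum (chips E₀ n) ≡ oddFibSum ks [mod fib (2 ℕ.* n) ]
    covers k 1≤k k≤n with chip-at k 1≤k k≤n
    ... | E , E≥0 , Ek≥1 , degE≤d , M∣ =
      chips E n , chips-InPath E n ℕ.≤-refl , length≤ E E≥0 degE≤d , ∈-chips E n k 1≤k k≤n Ek≥1 ,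
      chips-represent E₀ E E₀≥0 E≥0 M∣

  interval : ℕ → ℕ → ℕ → ℤ
  interval i₀ zero _ = 0ℤ
  interval i₀ (suc len) v = interval i₀ len v + δ (suc (i₀ ℕ.+ len)) v

  interval-nonneg : ∀ i₀ len v → 0ℤ ≤ interval i₀ len v
  interval-nonneg i₀ zero v = ≤-refl
  interval-nonneg i₀ (suc len) v = +-mono-≤ (interval-nonneg i₀ len v) (δ-nonneg _ v)

  interval-below : ∀ i₀ len v → v ℕ.≤ i₀ → interval i₀ len v ≡ 0ℤ
  interval-below i₀ zero v _ = refl
  interval-below i₀ (suc len) v v≤i₀ rewrite interval-below i₀ len v v≤i₀ =
    trans (+-identityˡ _) (δ-off (ℕ.<⇒≢ (s≤s (ℕ.≤-trans v≤i₀ (ℕ.m≤m+n i₀ len)))))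

  interval-above : ∀ i₀ len v → i₀ ℕ.+ len ℕ.< v → interval i₀ len v ≡ 0ℤ
  interval-above i₀ zero v _ = refl
  interval-above i₀ (suc len) v i₀+len<v
    rewrite interval-above i₀ len v (ℕ.≤-trans (s≤s (ℕ.+-monoʳ-≤ i₀ (ℕ.n≤1+n len))) i₀+len<v) =
    trans (+-identityˡ _) (δ-off (ℕ.>⇒≢ (subst (ℕ._< v) (ℕ.+-suc i₀ len) i₀+len<v)))

  interval-inside : ∀ i₀ len v → i₀ ℕ.< v → v ℕ.≤ i₀ ℕ.+ len → interval i₀ len v ≡ 1ℤ
  interval-inside i₀ zero v i₀<v v≤i₀ = ⊥-elim (ℕ.<⇒≱ i₀<v (subst (v ℕ.≤_) (ℕ.+-identityʳ i₀) v≤i₀))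
  interval-inside i₀ (suc len) v i₀<v v≤ with ℕ.m≤n⇒m<n∨m≡n (subst (v ℕ.≤_) (ℕ.+-suc i₀ len) v≤)
  ... | inj₁ v<end rewrite interval-inside i₀ len v i₀<v (ℕ.≤-pred v<end) | δ-off (ℕ.<⇒≢ v<end) = refl
  ... | inj₂ refl rewrite interval-above i₀ len (suc (i₀ ℕ.+ len)) ℕ.≤-refl | δ-diag (suc (i₀ ℕ.+ len)) = refl

  interval-≤1 : ∀ i₀ len v → interval i₀ len v ≤ 1ℤ
  interval-≤1 i₀ len v with v ℕ.≤? i₀ | v ℕ.≤? i₀ ℕ.+ len
  ... | yes v≤i₀ | _ = ≤-trans (≤-reflexive (interval-below i₀ len v v≤i₀)) (+≤+ z≤n)
  ... | no v≰i₀ | yes v≤end = ≤-reflexive (interval-inside i₀ len v (ℕ.≰⇒> v≰i₀) v≤end)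
  ... | no _ | no v≰end = ≤-trans (≤-reflexive (interval-above i₀ len v (ℕ.≰⇒> v≰end))) (+≤+ z≤n)

  deg-interval : ∀ i₀ len → i₀ ℕ.+ len ℕ.≤ n → deg (interval i₀ len) ≡ + len
  deg-interval i₀ zero _ = ∑-zero n
  deg-interval i₀ (suc len) end≤n = begin
    deg (λ v → interval i₀ len v + δ (suc (i₀ ℕ.+ len)) v)   ≡⟨ ∑-+ n (interval i₀ len) (δ (suc (i₀ ℕ.+ len))) ⟩
    deg (interval i₀ len) + deg (δ (suc (i₀ ℕ.+ len)))      ≡⟨ cong₂ _+_
        (deg-interval i₀ len (ℕ.≤-trans (ℕ.+-monoʳ-≤ i₀ (ℕ.n≤1+n len)) end≤n))
        (trans (∑-cong n (λ v _ _ → sym (*-identityˡ _)))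
               (∑-δ (λ _ → 1ℤ) (suc (i₀ ℕ.+ len)) n (s≤s z≤n) (subst (ℕ._≤ n) (ℕ.+-suc i₀ len) end≤n))) ⟩
    + len + 1ℤ                                              ≡⟨ cong +_ (ℕ.+-comm len 1) ⟩
    + suc len                                               ∎
    where open ≡-Reasoning

  module _ (E : ℕ → ℤ) (i₀ len : ℕ) (E≥0 : Effective E) (end≤n : i₀ ℕ.+ len ℕ.≤ n) where

    private
      I = interval i₀ len

    unfire-gains : ∀ v → i₀ ℕ.< v → v ℕ.≤ i₀ ℕ.+ len → 1ℤ ≤ E v + Δ I v
    unfire-gains v i₀<v v≤end = begin
      1ℤ              ≡⟨ +-identityˡ 1ℤ ⟨
      0ℤ + 1ℤ         ≤⟨ +-mono-≤ (E≥0 v (ℕ.≤-trans (s≤s z≤n) i₀<v) (ℕ.≤-trans v≤end end≤n))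
                                  (Δ-at-one-≥ I v (interval-inside i₀ len v i₀<v v≤end)
                                     (interval-≤1 i₀ len (pred v)) (interval-≤1 i₀ len (suc v))) ⟩
      E v + Δ I v     ∎
      where open ≤-Reasoning

    unfire-outside : ∀ v → I v ≡ 0ℤ → I (pred v) + I (suc v) ≤ E v → 0ℤ ≤ E v + Δ I v
    unfire-outside v Iv≡0 bound = begin
      0ℤ                               ≤⟨ i≤j⇒0≤j-i bound ⟩
      E v - (I (pred v) + I (suc v))   ≤⟨ +-monoʳ-≤ (E v) (Δ-at-zero-≥ I v Iv≡0
                                             (interval-nonneg i₀ len (pred v)) (interval-nonneg i₀ len (suc v))) ⟩
      E v + Δ I v                      ∎
      where open ≤-Reasoning

    -- Outside the run only its two neighbours lose a chip, which the hypotheses provide.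
    unfire-effective : (1 ℕ.≤ i₀ → 1ℤ ≤ E i₀) → (i₀ ℕ.+ len ℕ.< n → 1ℤ ≤ E (suc (i₀ ℕ.+ len))) →
      Effective (λ v → E v + Δ I v)
    unfire-effective left right v 1≤v v≤n with v ℕ.≤? i₀ | v ℕ.≤? i₀ ℕ.+ len
    ... | no v≰i₀ | yes v≤end = ≤-trans (+≤+ z≤n) (unfire-gains v (ℕ.≰⇒> v≰i₀) v≤end)
    ... | yes v≤i₀ | _ = unfire-outside v (interval-below i₀ len v v≤i₀) (begin
      I (pred v) + I (suc v)    ≡⟨ cong (_+ I (suc v)) (interval-below i₀ len (pred v) (ℕ.≤-trans ℕ.pred[n]≤n v≤i₀)) ⟩
      0ℤ + I (suc v)            ≡⟨ +-identityˡ _ ⟩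
      I (suc v)                 ≤⟨ next ⟩
      E v                       ∎)
      where
      open ≤-Reasoning
      next : I (suc v) ≤ E v
      next with ℕ.m≤n⇒m<n∨m≡n v≤i₀
      ... | inj₁ v<i₀ = ≤-trans (≤-reflexive (interval-below i₀ len (suc v) v<i₀)) (E≥0 v 1≤v v≤n)
      ... | inj₂ refl = ≤-trans (interval-≤1 i₀ len (suc v)) (left 1≤v)
    ... | no _ | no v≰end = unfire-outside v (interval-above i₀ len v end<v) (begin
      I (pred v) + I (suc v)    ≡⟨ cong (λ i → I (pred v) + i) (interval-above i₀ len (suc v) (ℕ.m<n⇒m<1+n end<v)) ⟩
      I (pred v) + 0ℤ           ≡⟨ +-identityʳ _ ⟩
      I (pred v)                ≤⟨ previous ⟩
      E v                       ∎)
      where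
      open ≤-Reasoning
      end<v = ℕ.≰⇒> v≰end
      pred≤⇒≤suc : ∀ {u m} → pred u ℕ.≤ m → u ℕ.≤ suc m
      pred≤⇒≤suc {zero} _ = z≤n
      pred≤⇒≤suc {suc _} pu≤m = s≤s pu≤m
      previous : I (pred v) ≤ E v
      previous with pred v ℕ.≤? i₀ ℕ.+ len
      ... | no pv≰end = ≤-trans (≤-reflexive (interval-above i₀ len (pred v) (ℕ.≰⇒> pv≰end))) (E≥0 v 1≤v v≤n)
      ... | yes pv≤end = ≤-trans (interval-≤1 i₀ len (pred v)) (subst (λ u → 1ℤ ≤ E u) end+1≡v (right (subst (ℕ._≤ n) (sym end+1≡v) v≤n)))
        where
        end+1≡v : suc (i₀ ℕ.+ len) ≡ v
        end+1≡v = ℕ.≤-antisym end<v (pred≤⇒≤suc pv≤end)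

  module Construction (ℓ′ : ℕ) where

    open import Data.Nat.DivMod using (_%_; _/_; m≡m%n+[m/n]*n; m%n<n; m*n%n≡0; [m+kn]%n≡m%n; m<n⇒m%n≡m; m<n*o⇒m/o<n)

    ℓ B : ℕ
    ℓ = suc ℓ′
    B = suc ℓ

    spaced : ℕ → ℤ
    spaced v = 𝟙 (does (v % B ℕ.≟ 0))

    spaced-nonneg : Effective spaced
    spaced-nonneg v _ _ = 𝟙-nonneg _

    spaced-multiple : ∀ t → spaced (t ℕ.* B) ≡ 1ℤ
    spaced-multiple t = cong 𝟙 (dec-true (t ℕ.* B % B ℕ.≟ 0) (m*n%n≡0 t B))

    spaced-between : ∀ t j → 1 ℕ.≤ j → j ℕ.< B → spaced (j ℕ.+ t ℕ.* B) ≡ 0ℤ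
    spaced-between t (suc j) _ j<B =
      cong 𝟙 (dec-false ((suc j ℕ.+ t ℕ.* B) % B ℕ.≟ 0) (λ eq → ℕ.1+n≢0 (trans (sym (m<n⇒m%n≡m j<B)) (trans (sym ([m+kn]%n≡m%n (suc j) t B)) eq))))

    ∑-spaced : ∀ t j → j ℕ.< B → ∑ (j ℕ.+ t ℕ.* B) spaced ≡ + t
    ∑-spaced zero zero _ = refl
    ∑-spaced (suc t) zero _ = trans (cong₂ _+_ (∑-spaced t ℓ ℕ.≤-refl) (spaced-multiple (suc t))) (cong +_ (ℕ.+-comm t 1))
    ∑-spaced t (suc j) j<B = trans (cong₂ _+_ (∑-spaced t j (ℕ.<-trans (ℕ.n<1+n j) j<B)) (spaced-between t (suc j) (s≤s z≤n) j<B))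
                                   (+-identityʳ (+ t))

    deg-spaced : deg spaced ≡ + (n / B)
    deg-spaced = trans (cong (λ m → ∑ m spaced) (m≡m%n+[m/n]*n n B)) (∑-spaced (n / B) (n % B) (m%n<n n B))

    -- A vertex k off the multiples of B lies in the gap after i₀ = ⌊k / B⌋ B, cut off at n.
    chip-at : ∀ k → 1 ℕ.≤ k → k ℕ.≤ n →
      Σ[ E ∈ (ℕ → ℤ) ] (Effective E × 1ℤ ≤ E k × deg E ≤ + (n / B ℕ.+ ℓ) × M ∣ weight spaced - weight E)
    chip-at k 1≤k k≤n with k % B in k%B≡r
    ... | zero = spaced , spaced-nonneg , ≤-reflexive (sym (cong 𝟙 (dec-true (k % B ℕ.≟ 0) k%B≡r))) ,
                 subst (_≤ + (n / B ℕ.+ ℓ)) (sym deg-spaced) (+≤+ (ℕ.m≤m+n (n / B) ℓ)) ,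
                 subst (M ∣_) (sym (+-inverseʳ (weight spaced))) (divides 0ℤ refl)
    ... | suc r′ = E , unfire-effective spaced i₀ len spaced-nonneg end≤n (λ _ → ≤-reflexive (sym (spaced-multiple t))) right ,
                   unfire-gains spaced i₀ len spaced-nonneg end≤n k i₀<k k≤end , degE≤ , unfire-same-class spaced I
      where
      t = k / B
      i₀ = t ℕ.* B
      len = ℓ ℕ.⊓ (n ℕ.∸ i₀)
      I = interval i₀ len
      E : ℕ → ℤ
      E v = spaced v + Δ I v
      k≡ : k ≡ suc r′ ℕ.+ i₀
      k≡ = trans (m≡m%n+[m/n]*n k B) (cong (ℕ._+ i₀) k%B≡r)
      i₀≤n : i₀ ℕ.≤ n
      i₀≤n = ℕ.≤-trans (ℕ.m≤n+m i₀ (suc r′)) (subst (ℕ._≤ n) k≡ k≤n)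
      end≤n : i₀ ℕ.+ len ℕ.≤ n
      end≤n = ℕ.≤-trans (ℕ.+-monoʳ-≤ i₀ (ℕ.m⊓n≤n ℓ (n ℕ.∸ i₀))) (ℕ.≤-reflexive (ℕ.m+[n∸m]≡n i₀≤n))
      i₀<k : i₀ ℕ.< k
      i₀<k = subst (i₀ ℕ.<_) (sym k≡) (s≤s (ℕ.m≤n+m i₀ r′))
      k≤end : k ℕ.≤ i₀ ℕ.+ len
      k≤end = subst (ℕ._≤ i₀ ℕ.+ len) (sym k≡) (subst (ℕ._≤ i₀ ℕ.+ len) (ℕ.+-comm i₀ (suc r′)) (ℕ.+-monoʳ-≤ i₀ (ℕ.⊓-glb
        (ℕ.≤-pred (subst (ℕ._< B) k%B≡r (m%n<n k B)))
        (subst (ℕ._≤ n ℕ.∸ i₀) (ℕ.m+n∸n≡m (suc r′) i₀) (ℕ.∸-monoˡ-≤ i₀ (subst (ℕ._≤ n) k≡ k≤n))))))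
      right : i₀ ℕ.+ len ℕ.< n → 1ℤ ≤ spaced (suc (i₀ ℕ.+ len))
      right end<n with ℕ.⊓-sel ℓ (n ℕ.∸ i₀)
      ... | inj₁ len≡ℓ = ≤-reflexive (sym (trans (cong (λ l → spaced (suc (i₀ ℕ.+ l))) len≡ℓ)
                                                (trans (cong (λ m → spaced (suc m)) (ℕ.+-comm i₀ ℓ)) (spaced-multiple (suc t)))))
      ... | inj₂ len≡n-i₀ = ⊥-elim (ℕ.<-irrefl (trans (cong (i₀ ℕ.+_) len≡n-i₀) (ℕ.m+[n∸m]≡n i₀≤n)) end<n)
      degE≤ : deg E ≤ + (n / B ℕ.+ ℓ)
      degE≤ = begin
        deg E                      ≡⟨ deg-unfire spaced I ⟩
        deg spaced + deg I         ≡⟨ cong₂ _+_ deg-spaced (deg-interval i₀ len end≤n) ⟩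
        + (n / B) + + len          ≡⟨ pos-+ (n / B) len ⟨
        + (n / B ℕ.+ len)          ≤⟨ +≤+ (ℕ.+-monoʳ-≤ (n / B) (ℕ.m⊓n≤m ℓ (n ℕ.∸ i₀))) ⟩
        + (n / B ℕ.+ ℓ)            ∎
        where open ≤-Reasoning

    spaced-covering : ∀ d m → m ℕ.+ ℓ ℕ.≤ d → suc n ℕ.≤ suc m ℕ.* B → CoveringClass d
    spaced-covering d m budget fits =
      divisors⇒covering d spaced spaced-nonneg (subst (_≤ + (d ℕ.∸ 1)) (sym deg-spaced) (+≤+ (ℕ.≤-trans q≤m m≤d-1)))
        (λ k 1≤k k≤n → relax (chip-at k 1≤k k≤n))
      where
      q≤m : n / B ℕ.≤ m
      q≤m = ℕ.≤-pred (m<n*o⇒m/o<n fits)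
      m≤d-1 : m ℕ.≤ d ℕ.∸ 1
      m≤d-1 = subst (ℕ._≤ d ℕ.∸ 1) (ℕ.m+n∸n≡m m 1) (ℕ.∸-monoˡ-≤ 1 (ℕ.≤-trans (ℕ.+-monoʳ-≤ m (s≤s z≤n)) budget))
      relax : ∀ {k} → Σ[ E ∈ (ℕ → ℤ) ] (Effective E × 1ℤ ≤ E k × deg E ≤ + (n / B ℕ.+ ℓ) × M ∣ weight spaced - weight E) →
        Σ[ E ∈ (ℕ → ℤ) ] (Effective E × 1ℤ ≤ E k × deg E ≤ + d × M ∣ weight spaced - weight E)
      relax (E , E≥0 , Ek≥1 , degE≤ , M∣) = E , E≥0 , Ek≥1 , ≤-trans degE≤ (+≤+ (ℕ.≤-trans (ℕ.+-monoˡ-≤ ℓ q≤m) budget)) , M∣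

  affordable⇒covering : ∀ d → Affordable n d → CoveringClass d
  affordable⇒covering d affordable with affordable-with-gap (s≤s z≤n) affordable
  ... | m , ℓ′ , budget , fits = Construction.spaced-covering ℓ′ d m budget fits

open import Data.Nat using (_≤_; _∸_; _*_; suc)
open import Function.Bundles using (_⇔_; mk⇔)

theorem1p5 : (n d : ℕ) → 1 ≤ n → 1 ≤ d →
    (∃ λ (x : ℕ) →
        (Σ (List ℕ) λ ks → All (λ k → 1 ≤ k × k ≤ n) ks × length ks ≤ d ∸ 1
           × x ≡ oddFibSum ks [mod fib (2 * n) ])
      × ((k : ℕ) → 1 ≤ k → k ≤ n →
          Σ (List ℕ) λ ks → All (λ j → 1 ≤ j × j ≤ n) ks × length ks ≤ d × k ∈ ks
           × x ≡ oddFibSum ks [mod fib (2 * n) ]))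
    ⇔ (φ n ≤ d)
theorem1p5 (suc p) d 1≤n 1≤d = mk⇔
  (λ covering → affordable⇒φ≤ 1≤n (covering⇒affordable d 1≤d covering))
  (λ φ≤d → affordable⇒covering d (φ≤⇒affordable 1≤n φ≤d))
  where
  open Phi using (affordable⇒φ≤; φ≤⇒affordable)
  open FanGraph p using (covering⇒affordable; affordable⇒covering)
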